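{- Let $m\ge2$, let $F\subseteq P_m$ be a face of the Kunz polyhedron, let $p_1,\dots,p_k$ be the atoms of the Kunz poset of $F$, and let $L$ be the set of affine linear functions $\mathbb R^{m-1}\to\mathbb R$. Then there exists a set \[ \rho_F\subseteq (L\times\mathbb Z_{\ge0}^k)\times(\{0\}\times\mathbb Z_{\ge0}^k) \] such that for every numerical semigroup $S$ of multiplicity $m$ whose Kunz tuple $x$ lies in the relative interior of $F$, the evaluation \[ \rho_F(x)=\{((\ell(x),z),(0,z')) : ((\ell,z),(0,z'))\in\rho_F\} \] is a minimal presentation of $S$.
   Context: The Kunz polyhedron $P_m\subseteq\mathbb R^{m-1}$ is defined by the inequalities $x_i+x_j\ge x_{i+j}$ for $1\le i\le j\le m-1$ with $i+j<m$, and $x_i+x_j+1\ge x_{i+j-m}$ for $1\le i\le j\le m-1$ with $i+j>m$. A face is a nonempty intersection of $P_m$ with the equality versions of some of these inequalities; its relative interior consists of points of the face in no proper subface. The map $T(x)_i=mx_i+i$ sends $P_m$ onto the group cone $\mathcal C(\mathbb Z_m)=\{y: y_i+y_j\ge y_{i+j}\ \forall i,j\in\mathbb Z_m\setminus\{0\},\ i+j\ne0\}$ (with $y_0=0$) and faces to faces. For a face $F$, with $F'=T(F)$ and $H=\{h: y_h=0\ \forall y\in F'\}$, the Kunz poset of $F$ is $\mathbb Z_m/H$ with $\overline0$ as unique minimum and $\overline a\preceq\overline b$ (distinct, $a,b\notin H$) iff $y_a+y_{b-a}=y_b$ for all $y\in F'$; its atoms are the elements covering $\overline 0$. For a numerical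 semigroup $S$ (cofinite submonoid of $\mathbb Z_{\ge0}$) with multiplicity (smallest positive element) $m$, write $\mathrm{Ap}(S;m)=\{n\in S:n-m\notin S\}=\{0,a_1,\dots,a_{m-1}\}$ with $a_i=mx_i+i$; $(x_1,\dots,x_{m-1})$ is the Kunz tuple. It is known that if the Kunz tuple of $S$ lies in the relative interior of $F$, then $H$ is trivial, the Kunz poset of $F$ equals that of $S$, and the minimal generators of $S$ are $m,n_1,\dots,n_k$ with $n_i\equiv p_i\pmod m$; factorizations of $S$ are taken in $\mathbb Z_{\ge0}^{k+1}$ with coordinate $0$ for $m$ and coordinate $i$ for $n_i$, i.e. $\varphi_S(z)=z_0m+\sum_{i\ge1}z_in_i$. A presentation of $S$ is a set $\rho$ of pairs $(z,z')$ with $\varphi_S(z)=\varphi_S(z')$ such that the smallest congruence on $\mathbb Z_{\ge0}^{k+1}$ containing $\rho$ is $\ker\varphi_S$; minimal means minimal under inclusion. -}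

module Defs where

open import Data.Nat using (ℕ; zero; suc; _+_; _*_; _∸_; _≤_; _<_; NonZero; _<?_)
open import Data.Nat.DivMod using (_%_)
open import Data.Integer using (+_)
open import Data.Rational using (ℚ; 0ℚ; 1ℚ; _/_) renaming (_+_ to _+ℚ_; _*_ to _*ℚ_; _≤_ to _≤ℚ_)
open import Data.Fin using (Fin; zero; suc; fromℕ<)
open import Data.Vec using (Vec; []; _∷_; zipWith)
open import Data.Product using (Σ; ∃; _×_; _,_)
open import Relation.Nullary using (¬_; yes; no)
open import Relation.Binary.PropositionalEquality using (_≡_; _≢_)

ℚof : ℕ → ℚ
ℚof n = (+ n) / 1

sumℚ : ∀ {n} → (Fin n → ℚ) → ℚ
sumℚ {zero} f = 0ℚ
sumℚ {suc n} f = f zero +ℚ sumℚ (λ i → f (suc i))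

-- points of Q^{m-1}; coordinate number i (1 ≤ i ≤ m-1) is stored at index i-1
Pt : ℕ → Set
Pt m = Fin (m ∸ 1) → ℚ

-- x_i for a natural index i (0 outside 1..m-1; x_0 = 0)
coord : (m : ℕ) → Pt m → ℕ → ℚ
coord m x zero = 0ℚ
coord m x (suc j) with j <? (m ∸ 1)
... | yes p = x (fromℕ< p)
... | no _ = 0ℚ

data Ineq (m : ℕ) : Set where
  -- x_i + x_j ≥ x_{i+j},  1 ≤ i ≤ j ≤ m-1, i+j < m
  lower : (i j : ℕ) → 1 ≤ i → i ≤ j → i + j < m → Ineq m
  -- x_i + x_j + 1 ≥ x_{i+j-m},  1 ≤ i ≤ j ≤ m-1, i+j > m
  upper : (i j : ℕ) → 1 ≤ i → i ≤ j → j < m → m < i + j → Ineq m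

ineqLHS : (m : ℕ) → Pt m → Ineq m → ℚ
ineqLHS m x (lower i j _ _ _) = coord m x i +ℚ coord m x j
ineqLHS m x (upper i j _ _ _ _) = coord m x i +ℚ coord m x j +ℚ 1ℚ

ineqRHS : (m : ℕ) → Pt m → Ineq m → ℚ
ineqRHS m x (lower i j _ _ _) = coord m x (i + j)
ineqRHS m x (upper i j _ _ _ _) = coord m x (i + j ∸ m)

Holds : (m : ℕ) → Pt m → Ineq m → Set
Holds m x e = ineqRHS m x e ≤ℚ ineqLHS m x e

Tight : (m : ℕ) → Pt m → Ineq m → Set
Tight m x e = ineqLHS m x e ≡ ineqRHS m x e

InKunz : (m : ℕ) → Pt m → Set
InKunz m x = ∀ e → Holds m x e

IsFace : (m : ℕ) → (Pt m → Set) → Set₁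
IsFace m F =
  (∃ λ x → F x) ×
  (Σ (Ineq m → Set) λ E →
     ∀ x → (F x → InKunz m x × (∀ e → E e → Tight m x e))
         × (InKunz m x × (∀ e → E e → Tight m x e) → F x))

RelInt : (m : ℕ) → (Pt m → Set) → Pt m → Set₁
RelInt m F x =
  F x × (∀ (G : Pt m → Set) → IsFace m G → (∀ y → G y → F y) → G x → ∀ y → F y → G y)

-- the map T: T(x)_a for a ∈ Z_m (represented by a natural number), y_0 = 0
yT : (m : ℕ) .{{_ : NonZero m}} → Pt m → ℕ → ℚ
yT m x a with a % m
... | zero = 0ℚ
... | suc r = ℚof m *ℚ coord m x (suc r) +ℚ ℚof (suc r)

subMod : (m : ℕ) .{{_ : NonZero m}} → ℕ → ℕ → ℕ
subMod m b a = (b + (m ∸ a % m)) % m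

InH : (m : ℕ) .{{_ : NonZero m}} → (Pt m → Set) → ℕ → Set
InH m F h = ∀ x → F x → yT m x h ≡ 0ℚ

SameClass : (m : ℕ) .{{_ : NonZero m}} → (Pt m → Set) → ℕ → ℕ → Set
SameClass m F a b = InH m F (subMod m b a)

-- ā ≼ b̄ for distinct nonzero classes: y_a + y_{b-a} = y_b for all y ∈ T(F)
KPrec : (m : ℕ) .{{_ : NonZero m}} → (Pt m → Set) → ℕ → ℕ → Set
KPrec m F a b = ∀ x → F x → yT m x a +ℚ yT m x (subMod m b a) ≡ yT m x b

IsAtom : (m : ℕ) .{{_ : NonZero m}} → (Pt m → Set) → ℕ → Set
IsAtom m F a =
  ¬ InH m F a ×
  (∀ c → ¬ InH m F c → ¬ SameClass m F c a → ¬ KPrec m F c a)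

AtomEnum : (m : ℕ) .{{_ : NonZero m}} → (Pt m → Set) → (k : ℕ) → (Fin k → ℕ) → Set
AtomEnum m F k p =
  (∀ i → IsAtom m F (p i)) ×
  (∀ i j → i ≢ j → ¬ SameClass m F (p i) (p j)) ×
  (∀ a → IsAtom m F a → ∃ λ i → SameClass m F a (p i))

IsNumSemigroup : (ℕ → Set) → Set
IsNumSemigroup S =
  S 0 × (∀ a b → S a → S b → S (a + b)) × (∃ λ N → ∀ n → N ≤ n → S n)

HasMultiplicity : ℕ → (ℕ → Set) → Set
HasMultiplicity m S = 0 < m × S m × (∀ n → 0 < n → n < m → ¬ S n)

-- x is the Kunz tuple of S: a_i = m x_i + i is the element of Ap(S;m) congruent to i
IsKunzTuple : (m : ℕ) .{{_ : NonZero m}} → (ℕ → Set) → Pt m → Set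
IsKunzTuple m S x =
  ∀ (i : Fin (m ∸ 1)) → ∃ λ a →
    (ℚof m *ℚ x i +ℚ ℚof (suc (Data.Fin.toℕ i)) ≡ ℚof a) ×
    (a % m ≡ suc (Data.Fin.toℕ i) % m) ×
    S a × (m ≤ a → ¬ S (a ∸ m))

IsMinGen : (ℕ → Set) → ℕ → Set
IsMinGen S g = S g × 0 < g × (∀ a b → S a → S b → 0 < a → 0 < b → a + b ≢ g)

dot : ∀ {k} → (Fin k → ℕ) → Vec ℕ k → ℕ
dot n [] = 0
dot n (z ∷ zs) = z * n zero + dot (λ i → n (suc i)) zs

φ : (m : ℕ) → ∀ {k} → (Fin k → ℕ) → Vec ℕ (suc k) → ℕ
φ m n (z₀ ∷ z) = z₀ * m + dot n z

data Cong {K : ℕ} (ρ : Vec ℕ K → Vec ℕ K → Set) : Vec ℕ K → Vec ℕ K → Set where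
  base  : ∀ {a b} → ρ a b → Cong ρ a b
  refl  : ∀ {a} → Cong ρ a a
  sym   : ∀ {a b} → Cong ρ a b → Cong ρ b a
  trans : ∀ {a b c} → Cong ρ a b → Cong ρ b c → Cong ρ a c
  add   : ∀ {a b} c → Cong ρ a b → Cong ρ (zipWith _+_ a c) (zipWith _+_ b c)

IsPresentation : ∀ {K} → (Vec ℕ K → ℕ) → (Vec ℕ K → Vec ℕ K → Set) → Set
IsPresentation f ρ = ∀ a b → (Cong ρ a b → f a ≡ f b) × (f a ≡ f b → Cong ρ a b)

IsMinimalPresentation : ∀ {K} → (Vec ℕ K → ℕ) → (Vec ℕ K → Vec ℕ K → Set) → Set₁
IsMinimalPresentation f ρ =
  IsPresentation f ρ ×
  (∀ (σ : Vec ℕ _ → Vec ℕ _ → Set) → (∀ a b → σ a b → ρ a b) → IsPresentation f σ →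
     ∀ a b → ρ a b → σ a b)

Affine : ℕ → Set
Affine m = ℚ × (Fin (m ∸ 1) → ℚ)

evalAff : (m : ℕ) → Affine m → Pt m → ℚ
evalAff m (c , v) x = c +ℚ sumℚ (λ i → v i *ℚ x i)

-- a set ρ_F ⊆ (L × ℕ^k) × ({0} × ℕ^k), element ((ℓ,z),(0,z')) stored as (ℓ , z , z')
RhoSet : ℕ → ℕ → Set₁
RhoSet m k = Affine m × Vec ℕ k × Vec ℕ k → Set

EvalIntegral : (m k : ℕ) → RhoSet m k → Pt m → Set
EvalIntegral m k ρ x = ∀ ℓ z z' → ρ (ℓ , z , z') → ∃ λ n → evalAff m ℓ x ≡ ℚof n

evalRho : (m k : ℕ) → RhoSet m k → Pt m → Vec ℕ (suc k) → Vec ℕ (suc k) → Set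
evalRho m k ρ x w w' =
  ∃ λ ℓ → ∃ λ z → ∃ λ z' → ∃ λ n →
    ρ (ℓ , z , z') × evalAff m ℓ x ≡ ℚof n × w ≡ n ∷ z × w' ≡ 0 ∷ z'

-- Write g = (m, n₁, …, n_k) for the generators and order factorizations by the multiplicity of m,
-- decreasing, then lexicographically.  Pairing the least factorization of every element s with the least
-- element of each other R-class of factorizations of s gives a minimal presentation (Rosales).  Through
-- the Apéry function A of S (A r is the least element of S congruent to r), a factorization of an Apéry
-- element is one whose partial sums are all additive for A, and for x in the relative interior of F the
-- additivity of A on a pair of residues is the tightness of their Kunz inequality on all of F.  Hence the
-- atom parts u, w of the pairs, their R-classes and least elements depend on F alone; only the multiplicity
-- t of m depends on S, and t = ℓ(x) for the affine ℓ with m ℓ(x) = Σ (w_i − u_i) a_{p_i}.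

module Submission where

open import Data.Nat
open import Data.Nat.Properties
open import Data.Nat.DivMod
open import Data.Nat.Induction using (<-rec; <-wellFounded)
open import Data.Nat.Tactic.RingSolver using (solve-∀)
open import Data.Nat.Coprimality using (1-coprimeTo) renaming (sym to coprime-sym)
open import Induction.WellFounded using (Acc; acc)
import Data.Integer as ℤ
import Data.Integer.Properties as ℤ
open import Data.Rational as ℚ using (ℚ; 0ℚ; 1ℚ; mkℚ; ↥_)
import Data.Rational.Properties as ℚ
import Data.Rational.Unnormalised.Base as ℚᵘ
import Data.Rational.Unnormalised.Properties as ℚᵘ
open import Data.Rational.Solver using (module +-*-Solver)
open import Algebra.Properties.Group ℚ.+-0-group using (∙-cancelʳ)
open import Data.Bool using (if_then_else_)
open import Data.Fin using (Fin; zero; suc; toℕ; fromℕ<)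
open import Data.Fin.Properties using (any?; toℕ-fromℕ<)
import Data.Fin.Properties as Fin
open import Data.Vec using (Vec; []; _∷_; zipWith; replicate; lookup)
open import Data.Vec.Properties using (lookup-zipWith; zipWith-identityʳ; ≡-dec)
open import Data.List using (List; []; _∷_; allFin)
open import Data.List.Membership.Propositional using (_∈_)
open import Data.List.Membership.Propositional.Properties using (∈-allFin)
open import Data.List.Relation.Unary.Any using (here; there)
open import Data.Product using (Σ; ∃; _×_; _,_; proj₁; proj₂; map₂)
open import Data.Sum using (_⊎_; inj₁; inj₂)
open import Data.Unit using (⊤; tt)
open import Data.Empty using (⊥; ⊥-elim)
open import Relation.Nullary using (¬_; Dec; yes; no)
open import Relation.Nullary.Decidable using (_×-dec_; _⊎-dec_; map′)
open import Relation.Unary using (Decidable)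
open import Relation.Binary.Definitions using (tri<; tri≈; tri>)
open import Relation.Binary.PropositionalEquality
open import Relation.Binary.Construct.Closure.ReflexiveTransitive as Star using (Star; ε; _◅_; _◅◅_)
open import Defs hiding (refl; sym; trans)
open +-*-Solver using (solve; _:+_; _:*_; _:-_; _:=_; con)

-- Factorizations

infixl 6 _⊕_
_⊕_ : ∀ {K} → Vec ℕ K → Vec ℕ K → Vec ℕ K
_⊕_ = zipWith _+_

𝟘 : ∀ {K} → Vec ℕ K
𝟘 {K} = replicate K 0

e[_] : ∀ {K} → Fin K → Vec ℕ K
e[_] {suc K} zero = 1 ∷ 𝟘
e[_] {suc K} (suc i) = 0 ∷ e[ i ]

_∈-supp_ : ∀ {K} → Fin K → Vec ℕ K → Set
i ∈-supp z = 0 < lookup z i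

⊕-identityʳ : ∀ {K} (a : Vec ℕ K) → a ⊕ 𝟘 ≡ a
⊕-identityʳ = zipWith-identityʳ +-identityʳ

dot-⊕ : ∀ {K} (g : Fin K → ℕ) (a b : Vec ℕ K) → dot g (a ⊕ b) ≡ dot g a + dot g b
dot-⊕ g [] [] = refl
dot-⊕ g (x ∷ a) (y ∷ b) rewrite dot-⊕ (λ i → g (suc i)) a b =
  interchange x y (g zero) (dot (λ i → g (suc i)) a) (dot (λ i → g (suc i)) b)
  where
    interchange : ∀ x y c A B → (x + y) * c + (A + B) ≡ (x * c + A) + (y * c + B)
    interchange = solve-∀

dot-𝟘 : ∀ {K} (g : Fin K → ℕ) → dot g 𝟘 ≡ 0
dot-𝟘 {zero} g = refl
dot-𝟘 {suc K} g = dot-𝟘 (λ i → g (suc i))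

dot-e : ∀ {K} (g : Fin K → ℕ) (i : Fin K) → dot g e[ i ] ≡ g i
dot-e {suc K} g zero = trans (cong (1 * g zero +_) (dot-𝟘 (λ i → g (suc i)))) (trans (+-identityʳ _) (*-identityˡ _))
dot-e {suc K} g (suc i) = dot-e (λ i → g (suc i)) i

dot-⊕e : ∀ {K} (g : Fin K → ℕ) z (i : Fin K) → dot g (z ⊕ e[ i ]) ≡ dot g z + g i
dot-⊕e g z i = trans (dot-⊕ g z e[ i ]) (cong (dot g z +_) (dot-e g i))

lookup-⊕ : ∀ {K} (a b : Vec ℕ K) i → lookup (a ⊕ b) i ≡ lookup a i + lookup b i
lookup-⊕ a b i = lookup-zipWith _+_ i a b

lookup-e : ∀ {K} (i : Fin K) → lookup e[ i ] i ≡ 1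
lookup-e {suc K} zero = refl
lookup-e {suc K} (suc i) = lookup-e i

∈-supp⇒⊕e : ∀ {K} (z : Vec ℕ K) {i} → i ∈-supp z → ∃ λ z′ → z ≡ z′ ⊕ e[ i ]
∈-supp⇒⊕e (suc x ∷ z) {zero} (s≤s z≤n) = x ∷ z , cong₂ _∷_ (+-comm 1 x) (sym (⊕-identityʳ z))
∈-supp⇒⊕e (x ∷ z) {suc i} i∈z with ∈-supp⇒⊕e z i∈z
... | z′ , eq = x ∷ z′ , cong₂ _∷_ (sym (+-identityʳ x)) eq

∈-supp-⊕e : ∀ {K} (z : Vec ℕ K) i → i ∈-supp (z ⊕ e[ i ])
∈-supp-⊕e z i rewrite lookup-⊕ z e[ i ] i | lookup-e i = m≤n+m 1 (lookup z i)

∈-supp-⊕ˡ : ∀ {K} (a b : Vec ℕ K) {i} → i ∈-supp a → i ∈-supp (a ⊕ b)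
∈-supp-⊕ˡ a b {i} i∈a rewrite lookup-⊕ a b i = ≤-trans i∈a (m≤m+n _ _)

∈-supp-⊕ʳ : ∀ {K} (a b : Vec ℕ K) {i} → i ∈-supp b → i ∈-supp (a ⊕ b)
∈-supp-⊕ʳ a b {i} i∈b rewrite lookup-⊕ a b i = ≤-trans i∈b (m≤n+m _ _)

≡𝟘⊎supp : ∀ {K} (z : Vec ℕ K) → z ≡ 𝟘 ⊎ ∃ (_∈-supp z)
≡𝟘⊎supp [] = inj₁ refl
≡𝟘⊎supp (suc x ∷ z) = inj₂ (zero , s≤s z≤n)
≡𝟘⊎supp (zero ∷ z) with ≡𝟘⊎supp z
... | inj₁ refl = inj₁ refl
... | inj₂ (i , i∈z) = inj₂ (suc i , i∈z)

lookup≤dot : ∀ {K} (g : Fin K → ℕ) → (∀ i → 0 < g i) → ∀ (z : Vec ℕ K) i → lookup z i ≤ dot g z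
lookup≤dot g g>0 (x ∷ z) zero = ≤-trans (≤-trans (≤-reflexive (sym (*-identityʳ x))) (*-monoʳ-≤ x (g>0 zero))) (m≤m+n _ _)
lookup≤dot g g>0 (x ∷ z) (suc i) = ≤-trans (lookup≤dot (λ i → g (suc i)) (λ i → g>0 (suc i)) z i) (m≤n+m _ _)

dot≡0⇒𝟘 : ∀ {K} (g : Fin K → ℕ) → (∀ i → 0 < g i) → ∀ z → dot g z ≡ 0 → z ≡ 𝟘
dot≡0⇒𝟘 g g>0 z eq with ≡𝟘⊎supp z
... | inj₁ z≡𝟘 = z≡𝟘
... | inj₂ (i , i∈z) = ⊥-elim (1+n≰n (subst (0 <_) eq (≤-trans i∈z (lookup≤dot g g>0 z i))))

infix 4 _≤L_ _≤O_

_≤L_ : ∀ {K} → Vec ℕ K → Vec ℕ K → Set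
[] ≤L [] = ⊤
(x ∷ a) ≤L (y ∷ b) = x < y ⊎ (x ≡ y × a ≤L b)

-- Reversed on the first coordinate (the multiplicity of m): least factorizations use m as often as possible.
_≤O_ : ∀ {K} → Vec ℕ (suc K) → Vec ℕ (suc K) → Set
(t ∷ u) ≤O (t′ ∷ u′) = t′ < t ⊎ (t ≡ t′ × u ≤L u′)

≤L-antisym : ∀ {K} (a b : Vec ℕ K) → a ≤L b → b ≤L a → a ≡ b
≤L-antisym [] [] _ _ = refl
≤L-antisym (x ∷ a) (y ∷ b) (inj₁ x<y) (inj₁ y<x) = ⊥-elim (<-asym x<y y<x)
≤L-antisym (x ∷ a) (y ∷ b) (inj₁ x<y) (inj₂ (refl , _)) = ⊥-elim (<-irrefl refl x<y)
≤L-antisym (x ∷ a) (y ∷ b) (inj₂ (refl , _)) (inj₁ y<x) = ⊥-elim (<-irrefl refl y<x)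
≤L-antisym (x ∷ a) (y ∷ b) (inj₂ (refl , a≤b)) (inj₂ (_ , b≤a)) = cong (x ∷_) (≤L-antisym a b a≤b b≤a)

≤O-antisym : ∀ {K} (a b : Vec ℕ (suc K)) → a ≤O b → b ≤O a → a ≡ b
≤O-antisym (x ∷ a) (y ∷ b) (inj₁ y<x) (inj₁ x<y) = ⊥-elim (<-asym x<y y<x)
≤O-antisym (x ∷ a) (y ∷ b) (inj₁ y<x) (inj₂ (refl , _)) = ⊥-elim (<-irrefl refl y<x)
≤O-antisym (x ∷ a) (y ∷ b) (inj₂ (refl , _)) (inj₁ x<y) = ⊥-elim (<-irrefl refl x<y)
≤O-antisym (x ∷ a) (y ∷ b) (inj₂ (refl , a≤b)) (inj₂ (_ , b≤a)) = cong (x ∷_) (≤L-antisym a b a≤b b≤a)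

≤O-cons0⇒≤L : ∀ {K} {a b : Vec ℕ K} → (0 ∷ a) ≤O (0 ∷ b) → a ≤L b
≤O-cons0⇒≤L (inj₂ (_ , a≤b)) = a≤b

IsLeast : ∀ {A : Set} → (A → A → Set) → (A → Set) → A → Set
IsLeast _≼_ P a = P a × (∀ b → P b → a ≼ b)

IsLeast-unique : ∀ {A : Set} {_≼_ : A → A → Set} {P : A → Set} →
  (∀ a b → a ≼ b → b ≼ a → a ≡ b) → ∀ {a b} → IsLeast _≼_ P a → IsLeast _≼_ P b → a ≡ b
IsLeast-unique antisym {a} {b} (pa , a≼) (pb , b≼) = antisym a b (a≼ b pb) (b≼ a pa)

least-ℕ : ∀ {Q : ℕ → Set} → Decidable Q → ∀ {x} → Q x → ∃ (IsLeast _≤_ Q)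
least-ℕ {Q} Q? {x} = go x (<-wellFounded x)
  where
    go : ∀ x → Acc _<_ x → Q x → ∃ (IsLeast _≤_ Q)
    go x (acc rs) qx with anyUpTo? Q? x
    ... | yes (y , y<x , qy) = go y (rs y<x) qy
    ... | no ∄y<x = x , qx , λ y qy → ≮⇒≥ (λ y<x → ∄y<x (y , y<x , qy))

greatest-ℕ : ∀ {Q : ℕ → Set} → Decidable Q → ∀ B → (∀ y → Q y → y ≤ B) → ∀ {x} → Q x → ∃ (IsLeast _≥_ Q)
greatest-ℕ Q? zero bound {x} qx with bound x qx
... | z≤n = 0 , qx , bound
greatest-ℕ {Q} Q? (suc B) bound qx with Q? (suc B)
... | yes qB = suc B , qB , bound
... | no ¬qB = greatest-ℕ Q? B bound′ qx
  where
    bound′ : ∀ y → Q y → y ≤ B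
    bound′ y qy with m≤n⇒m<n∨m≡n (bound y qy)
    ... | inj₁ y<1+B = ≤-pred y<1+B
    ... | inj₂ refl = ⊥-elim (¬qB qy)

BoundedBy : ∀ {K} → ℕ → (Vec ℕ K → Set) → Set
BoundedBy B P = ∀ z → P z → ∀ i → lookup z i ≤ B

module _ {K : ℕ} {P : Vec ℕ (suc K) → Set} {B : ℕ} (bound : BoundedBy B P) where

  tail-bounded : ∀ x → BoundedBy B (λ r → P (x ∷ r))
  tail-bounded x r p i = bound (x ∷ r) p (suc i)

  head-bounded : ∀ x r → P (x ∷ r) → x ≤ B
  head-bounded x r p = bound (x ∷ r) p zero

∃?-bounded : ∀ {K} {P : Vec ℕ K → Set} → Decidable P → ∀ {B} → BoundedBy B P → Dec (∃ P)
∃?-bounded {zero} P? bound with P? []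
... | yes p = yes ([] , p)
... | no ¬p = no λ { ([] , p) → ¬p p }
∃?-bounded {suc K} P? {B} bound
  with anyUpTo? (λ x → ∃?-bounded (λ r → P? (x ∷ r)) (tail-bounded bound x)) (suc B)
... | yes (x , _ , r , p) = yes (x ∷ r , p)
... | no ∄ = no λ { (x ∷ r , p) → ∄ (x , s≤s (head-bounded bound x r p) , r , p) }

≤L-least : ∀ {K} {P : Vec ℕ K → Set} → Decidable P → ∀ {B} → BoundedBy B P → ∃ P → ∃ (IsLeast _≤L_ P)
≤L-least {zero} P? bound ([] , p) = [] , p , λ { [] _ → tt }
≤L-least {suc K} {P} P? bound (x₀ ∷ r₀ , p₀)
  with least-ℕ (λ x → ∃?-bounded (λ r → P? (x ∷ r)) (tail-bounded bound x)) (r₀ , p₀)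
... | x , (r₁ , p₁) , x-least
  with ≤L-least (λ r → P? (x ∷ r)) (tail-bounded bound x) (r₁ , p₁)
... | r , p , r-least = x ∷ r , p , λ { (y ∷ r′) p′ → by-head (m≤n⇒m<n∨m≡n (x-least y (r′ , p′))) r′ p′ }
  where
    by-head : ∀ {y} → x < y ⊎ x ≡ y → ∀ r′ → P (y ∷ r′) → (x ∷ r) ≤L (y ∷ r′)
    by-head (inj₁ x<y) _ _ = inj₁ x<y
    by-head (inj₂ refl) r′ p′ = inj₂ (refl , r-least r′ p′)

≤O-least : ∀ {K} {P : Vec ℕ (suc K) → Set} → Decidable P → ∀ {B} → BoundedBy B P → ∃ P → ∃ (IsLeast _≤O_ P)
≤O-least {K} {P} P? {B} bound (x₀ ∷ r₀ , p₀)
  with greatest-ℕ (λ x → ∃?-bounded (λ r → P? (x ∷ r)) (tail-bounded bound x)) B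
                  (λ y (r , p) → head-bounded bound y r p) (r₀ , p₀)
... | x , (r₁ , p₁) , x-greatest
  with ≤L-least (λ r → P? (x ∷ r)) (tail-bounded bound x) (r₁ , p₁)
... | r , p , r-least = x ∷ r , p , λ { (y ∷ r′) p′ → by-head (m≤n⇒m<n∨m≡n (x-greatest y (r′ , p′))) r′ p′ }
  where
    by-head : ∀ {y} → y < x ⊎ y ≡ x → ∀ r′ → P (y ∷ r′) → (x ∷ r) ≤O (y ∷ r′)
    by-head (inj₁ y<x) _ _ = inj₁ y<x
    by-head (inj₂ refl) r′ p′ = inj₂ (refl , r-least r′ p′)

-- Reachability in a finite graph

module _ {K : ℕ} {E : Fin K → Fin K → Set} (E? : ∀ i j → Dec (E i j)) where

  private
    EdgeInto : List (Fin K) → Fin K → Fin K → Set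
    EdgeInto L i j = E i j × j ∈ L

    AvoidsOrVisits : Fin K → List (Fin K) → Fin K → Fin K → Set
    AvoidsOrVisits v L i j = Star (EdgeInto L) i j ⊎ ∃ λ u → Star (EdgeInto L) i u × E u v × Star (EdgeInto L) v j

    -- A path through the vertices v ∷ L avoids v, or factors through its last visit to v.
    split : ∀ {v L i j} → Star (EdgeInto (v ∷ L)) i j → AvoidsOrVisits v L i j
    split ε = inj₁ ε
    split {i = i} ((x , here refl) ◅ w) with split w
    ... | inj₁ w′ = inj₂ (i , ε , x , w′)
    ... | inj₂ (_ , _ , _ , w₂) = inj₂ (i , ε , x , w₂)
    split ((x , there j∈L) ◅ w) with split w
    ... | inj₁ w′ = inj₁ ((x , j∈L) ◅ w′)
    ... | inj₂ (u , w₁ , y , w₂) = inj₂ (u , (x , j∈L) ◅ w₁ , y , w₂)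

    widen : ∀ {v L i j} → Star (EdgeInto L) i j → Star (EdgeInto (v ∷ L)) i j
    widen = Star.map (map₂ there)

    reach-via? : ∀ L i j → Dec (Star (EdgeInto L) i j)
    reach-via? [] i j with i Fin.≟ j
    ... | yes refl = yes ε
    ... | no i≢j = no λ { ε → i≢j refl ; ((_ , ()) ◅ _) }
    reach-via? (v ∷ L) i j =
      map′ join split
        (reach-via? L i j ⊎-dec any? (λ u → reach-via? L i u ×-dec (E? u v ×-dec reach-via? L v j)))
      where
        join : AvoidsOrVisits v L i j → Star (EdgeInto (v ∷ L)) i j
        join (inj₁ w) = widen w
        join (inj₂ (u , w₁ , y , w₂)) = widen w₁ ◅◅ (y , here refl) ◅ widen w₂

  reach? : ∀ i j → Dec (Star E i j)
  reach? i j = map′ (Star.map proj₁) (Star.map (λ x → x , ∈-allFin _)) (reach-via? (allFin K) i j)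

-- Minimal presentations from least elements

Cong-mono : ∀ {K} {ρ ρ′ : Vec ℕ K → Vec ℕ K → Set} → (∀ a b → ρ a b → ρ′ a b) →
            ∀ {a b} → Cong ρ a b → Cong ρ′ a b
Cong-mono ρ⊆ρ′ (base r) = base (ρ⊆ρ′ _ _ r)
Cong-mono ρ⊆ρ′ Cong.refl = Cong.refl
Cong-mono ρ⊆ρ′ (Cong.sym c) = Cong.sym (Cong-mono ρ⊆ρ′ c)
Cong-mono ρ⊆ρ′ (Cong.trans c c′) = Cong.trans (Cong-mono ρ⊆ρ′ c) (Cong-mono ρ⊆ρ′ c′)
Cong-mono ρ⊆ρ′ (add c x) = add c (Cong-mono ρ⊆ρ′ x)

IsPresentation-resp : ∀ {K} {f f′ : Vec ℕ K → ℕ} {ρ ρ′ : Vec ℕ K → Vec ℕ K → Set} →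
  (∀ a → f a ≡ f′ a) → (∀ a b → ρ a b → ρ′ a b) → (∀ a b → ρ′ a b → ρ a b) →
  IsPresentation f ρ → IsPresentation f′ ρ′
IsPresentation-resp f≗f′ ρ⊆ρ′ ρ′⊆ρ pres a b =
  (λ c → trans (sym (f≗f′ a)) (trans (proj₁ (pres a b) (Cong-mono ρ′⊆ρ c)) (f≗f′ b))) ,
  (λ eq → Cong-mono ρ⊆ρ′ (proj₂ (pres a b) (trans (f≗f′ a) (trans eq (sym (f≗f′ b))))))

IsMinimalPresentation-resp : ∀ {K} {f f′ : Vec ℕ K → ℕ} {ρ ρ′ : Vec ℕ K → Vec ℕ K → Set} →
  (∀ a → f a ≡ f′ a) → (∀ a b → ρ a b → ρ′ a b) → (∀ a b → ρ′ a b → ρ a b) →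
  IsMinimalPresentation f ρ → IsMinimalPresentation f′ ρ′
IsMinimalPresentation-resp f≗f′ ρ⊆ρ′ ρ′⊆ρ (pres , minimal) =
  IsPresentation-resp f≗f′ ρ⊆ρ′ ρ′⊆ρ pres ,
  λ σ σ⊆ρ′ σ-pres a b ρ′ab → minimal σ (λ x y σxy → ρ′⊆ρ x y (σ⊆ρ′ x y σxy))
    (IsPresentation-resp (λ z → sym (f≗f′ z)) (λ _ _ σxy → σxy) (λ _ _ σxy → σxy) σ-pres) a b (ρ′⊆ρ a b ρ′ab)

data Connected {K} (E : Fin K → Fin K → Set) (z z′ : Vec ℕ K) : Set where
  connected : ∀ {i j} → i ∈-supp z → j ∈-supp z′ → Star E i j → Connected E z z′

Connected-map : ∀ {K} {E E′ : Fin K → Fin K → Set} → (∀ {i j} → E i j → E′ i j) →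
                ∀ {z z′} → Connected E z z′ → Connected E′ z z′
Connected-map f (connected i∈z j∈z′ w) = connected i∈z j∈z′ (Star.map f w)

-- Rosales' construction: the least factorization of s is paired with the least element of every other
-- R-class of factorizations of s.  Any order with least elements on bounded decidable sets will do.
module LeastPresentation {K : ℕ} (g : Fin K → ℕ) (g>0 : ∀ i → 0 < g i)
  (_≼_ : Vec ℕ K → Vec ℕ K → Set) (≼-antisym : ∀ a b → a ≼ b → b ≼ a → a ≡ b)
  (≼-least : ∀ {P : Vec ℕ K → Set} → (∀ z → Dec (P z)) → ∀ {B} → BoundedBy B P → ∃ P → ∃ (IsLeast _≼_ P))
  where

  ⟦_⟧ : Vec ℕ K → ℕ
  ⟦ z ⟧ = dot g z

  ⟦⟧-⊕ : ∀ a b → ⟦ a ⊕ b ⟧ ≡ ⟦ a ⟧ + ⟦ b ⟧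
  ⟦⟧-⊕ = dot-⊕ g

  factorizations-bounded : ∀ s → BoundedBy s (λ z → ⟦ z ⟧ ≡ s)
  factorizations-bounded s z refl = lookup≤dot g g>0 z

  Linked : ℕ → Fin K → Fin K → Set
  Linked s i j = ∃ λ z → ⟦ z ⟧ ≡ s × i ∈-supp z × j ∈-supp z

  Linked? : ∀ s i j → Dec (Linked s i j)
  Linked? s i j = ∃?-bounded (λ z → (⟦ z ⟧ ≟ s) ×-dec ((0 <? lookup z i) ×-dec (0 <? lookup z j)))
                             (λ z p → factorizations-bounded s z (proj₁ p))

  Linked-sym : ∀ {s i j} → Linked s i j → Linked s j i
  Linked-sym (z , eq , i∈z , j∈z) = z , eq , j∈z , i∈z

  infix 4 _∼[_]_
  _∼[_]_ : Vec ℕ K → ℕ → Vec ℕ K → Set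
  z ∼[ s ] z′ = Connected (Linked s) z z′

  ∼-refl : ∀ z {i} → i ∈-supp z → z ∼[ ⟦ z ⟧ ] z
  ∼-refl z i∈z = connected i∈z i∈z ε

  ∼-sym : ∀ {z s z′} → z ∼[ s ] z′ → z′ ∼[ s ] z
  ∼-sym (connected i∈z j∈z′ w) = connected j∈z′ i∈z (Star.reverse Linked-sym w)

  ∼-trans : ∀ {z z′ z″ s} → ⟦ z′ ⟧ ≡ s → z ∼[ s ] z′ → z′ ∼[ s ] z″ → z ∼[ s ] z″
  ∼-trans {z′ = z′} eq (connected i∈z j∈z′ w) (connected j′∈z′ l∈z″ w′) =
    connected i∈z l∈z″ (w ◅◅ (z′ , eq , j∈z′ , j′∈z′) ◅ w′)

  ∼? : ∀ z s z′ → Dec (z ∼[ s ] z′)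
  ∼? z s z′ = map′ (λ (_ , _ , i∈z , j∈z′ , w) → connected i∈z j∈z′ w)
                   (λ { (connected i∈z j∈z′ w) → _ , _ , i∈z , j∈z′ , w })
                   (any? λ i → any? λ j → (0 <? lookup z i) ×-dec ((0 <? lookup z′ j) ×-dec reach? (Linked? s) i j))

  shared-∼ : ∀ a b c {i} → i ∈-supp c → (a ⊕ c) ∼[ ⟦ a ⊕ c ⟧ ] (b ⊕ c)
  shared-∼ a b c i∈c = connected (∈-supp-⊕ʳ a c i∈c) (∈-supp-⊕ʳ b c i∈c) ε

  IsLeastFact : ℕ → Vec ℕ K → Set
  IsLeastFact s = IsLeast _≼_ (λ z → ⟦ z ⟧ ≡ s)

  IsClassLeast : ℕ → Vec ℕ K → Set
  IsClassLeast s b = ⟦ b ⟧ ≡ s × (∀ z → ⟦ z ⟧ ≡ s → z ∼[ s ] b → b ≼ z)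

  ρ : Vec ℕ K → Vec ℕ K → Set
  ρ a b = IsLeastFact ⟦ b ⟧ a × IsClassLeast ⟦ b ⟧ b × a ≢ b

  leastFact : ∀ s a → ⟦ a ⟧ ≡ s → ∃ (IsLeastFact s)
  leastFact s a eq = ≼-least (λ z → ⟦ z ⟧ ≟ s) (factorizations-bounded s) (a , eq)

  least-not-∼-other-class-least : ∀ {s a b} → IsLeastFact s a → IsClassLeast s b → a ≢ b → ¬ a ∼[ s ] b
  least-not-∼-other-class-least (⟦a⟧ , a-least) (⟦b⟧ , b-least) a≢b a∼b =
    a≢b (≼-antisym _ _ (a-least _ ⟦b⟧) (b-least _ ⟦a⟧ a∼b))

  Cong-sound : ∀ {a b} → Cong ρ a b → ⟦ a ⟧ ≡ ⟦ b ⟧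
  Cong-sound (base ((eq , _) , _)) = eq
  Cong-sound Cong.refl = refl
  Cong-sound (Cong.sym c) = sym (Cong-sound c)
  Cong-sound (Cong.trans c c′) = trans (Cong-sound c) (Cong-sound c′)
  Cong-sound (add {a} {b} c x) = trans (⟦⟧-⊕ a c) (trans (cong (_+ ⟦ c ⟧) (Cong-sound x)) (sym (⟦⟧-⊕ b c)))

  CompleteAt : ℕ → Set
  CompleteAt s = ∀ a b → ⟦ a ⟧ ≡ s → ⟦ b ⟧ ≡ s → Cong ρ a b

  module _ {s} (IH : ∀ {s′} → s′ < s → CompleteAt s′) where

    shared⇒Cong : ∀ a b {i} → ⟦ a ⟧ ≡ s → ⟦ b ⟧ ≡ s → i ∈-supp a → i ∈-supp b → Cong ρ a b
    shared⇒Cong a b {i} ⟦a⟧ ⟦b⟧ i∈a i∈b with ∈-supp⇒⊕e a i∈a | ∈-supp⇒⊕e b i∈b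
    ... | a′ , refl | b′ , refl = add e[ i ] (IH ⟦a′⟧<s a′ b′ refl ⟦b′⟧≡⟦a′⟧)
      where
        ⟦a′⟧<s : ⟦ a′ ⟧ < s
        ⟦a′⟧<s = subst (⟦ a′ ⟧ <_) (trans (sym (dot-⊕e g a′ i)) ⟦a⟧)
                   (subst (_≤ ⟦ a′ ⟧ + g i) (+-comm ⟦ a′ ⟧ 1) (+-monoʳ-≤ ⟦ a′ ⟧ (g>0 i)))
        ⟦b′⟧≡⟦a′⟧ : ⟦ b′ ⟧ ≡ ⟦ a′ ⟧
        ⟦b′⟧≡⟦a′⟧ = +-cancelʳ-≡ _ _ _ (trans (sym (dot-⊕e g b′ i)) (trans ⟦b⟧ (trans (sym ⟦a⟧) (dot-⊕e g a′ i))))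

    path⇒Cong : ∀ {i j} → Star (Linked s) i j →
                ∀ a b → ⟦ a ⟧ ≡ s → ⟦ b ⟧ ≡ s → i ∈-supp a → j ∈-supp b → Cong ρ a b
    path⇒Cong ε a b ⟦a⟧ ⟦b⟧ i∈a i∈b = shared⇒Cong a b ⟦a⟧ ⟦b⟧ i∈a i∈b
    path⇒Cong ((c , ⟦c⟧ , i∈c , l∈c) ◅ w) a b ⟦a⟧ ⟦b⟧ i∈a j∈b =
      Cong.trans (shared⇒Cong a c ⟦a⟧ ⟦c⟧ i∈a i∈c) (path⇒Cong w c b ⟦c⟧ ⟦b⟧ l∈c j∈b)

    ∼⇒Cong : ∀ a b → ⟦ a ⟧ ≡ s → ⟦ b ⟧ ≡ s → a ∼[ s ] b → Cong ρ a b
    ∼⇒Cong a b ⟦a⟧ ⟦b⟧ (connected i∈a j∈b w) = path⇒Cong w a b ⟦a⟧ ⟦b⟧ i∈a j∈b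

    -- The least element c of the R-class of a is either the least factorization or ρ-related to it.
    Cong-leastFact : ∀ a μ → ⟦ a ⟧ ≡ s → IsLeastFact s μ → Cong ρ a μ
    Cong-leastFact a μ ⟦a⟧ (⟦μ⟧ , μ≼) with ≡𝟘⊎supp a
    ... | inj₁ refl = subst (Cong ρ 𝟘) (sym (dot≡0⇒𝟘 g g>0 μ (trans ⟦μ⟧ (trans (sym ⟦a⟧) (dot-𝟘 g))))) Cong.refl
    ... | inj₂ (i , i∈a)
      with ≼-least (λ z → (⟦ z ⟧ ≟ s) ×-dec ∼? z s a) (λ z p → factorizations-bounded s z (proj₁ p))
                   (a , ⟦a⟧ , subst (a ∼[_] a) ⟦a⟧ (∼-refl a i∈a))
    ... | c , (⟦c⟧ , c∼a) , c-least with ≡-dec _≟_ c μ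
    ...   | yes c≡μ = subst (Cong ρ a) c≡μ (Cong.sym (∼⇒Cong c a ⟦c⟧ ⟦a⟧ c∼a))
    ...   | no c≢μ = Cong.trans (Cong.sym (∼⇒Cong c a ⟦c⟧ ⟦a⟧ c∼a)) (Cong.sym (base μρc))
      where
        μρc : ρ μ c
        μρc = (trans ⟦μ⟧ (sym ⟦c⟧) , λ z ⟦z⟧ → μ≼ z (trans ⟦z⟧ ⟦c⟧)) ,
              (refl , λ z ⟦z⟧ z∼c → c-least z (trans ⟦z⟧ ⟦c⟧ ,
                 ∼-trans ⟦c⟧ (subst (z ∼[_] c) ⟦c⟧ z∼c) c∼a)) ,
              (λ μ≡c → c≢μ (sym μ≡c))

    completeAt : CompleteAt s
    completeAt a b ⟦a⟧ ⟦b⟧ with leastFact s a ⟦a⟧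
    ... | μ , μ-least = Cong.trans (Cong-leastFact a μ ⟦a⟧ μ-least) (Cong.sym (Cong-leastFact b μ ⟦b⟧ μ-least))

  isPresentation : IsPresentation ⟦_⟧ ρ
  isPresentation a b = Cong-sound , λ eq → <-rec CompleteAt (λ s IH → completeAt IH) ⟦ b ⟧ a b eq refl

  -- Unless (a, b) ∈ σ, every step of a congruence generated by σ ⊆ ρ keeps a factorization of ⟦ b ⟧ inside or
  -- outside the R-class of b; since a lies outside and b inside, σ must contain (a, b).
  module _ (σ : Vec ℕ K → Vec ℕ K → Set) (σ⊆ρ : ∀ a b → σ a b → ρ a b) {a b : Vec ℕ K} (ρab : ρ a b) where

    private
      s = ⟦ b ⟧
      a-least = proj₁ ρab
      b-classLeast = proj₁ (proj₂ ρab)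
      a≢b = proj₂ (proj₂ ρab)
      a≁b = least-not-∼-other-class-least a-least b-classLeast a≢b

    PreservesClass : Vec ℕ K → Vec ℕ K → Set
    PreservesClass x y = ⟦ x ⟧ ≡ ⟦ y ⟧ × (⟦ x ⟧ ≡ s → (x ∼[ s ] b → y ∼[ s ] b) × (y ∼[ s ] b → x ∼[ s ] b))

    other-σ-preserves : ∀ x y → σ x y → (x ≡ a → y ≡ b → ⊥) → PreservesClass x y
    other-σ-preserves x y σxy not-ab with σ⊆ρ x y σxy
    ... | x-least@(⟦x⟧ , _) , y-classLeast@(_ , y-least) , _ = ⟦x⟧ , λ ⟦x⟧≡s →
      let ⟦y⟧≡s = trans (sym ⟦x⟧) ⟦x⟧≡s
          x≡a = IsLeast-unique ≼-antisym (subst (λ t → IsLeastFact t x) ⟦y⟧≡s x-least) a-least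
      in (λ x∼b → ⊥-elim (a≁b (subst (_∼[ s ] b) x≡a x∼b))) ,
         (λ y∼b → ⊥-elim (not-ab x≡a (≼-antisym y b (y-least b (sym ⟦y⟧≡s) (subst (b ∼[_] y) (sym ⟦y⟧≡s) (∼-sym y∼b)))
                                                   (proj₂ b-classLeast y ⟦y⟧≡s y∼b))))

    Cong-preserves : ∀ {x y} → Cong σ x y → σ a b ⊎ PreservesClass x y
    Cong-preserves (base {x} {y} σxy) with ≡-dec _≟_ x a | ≡-dec _≟_ y b
    ... | yes refl | yes refl = inj₁ σxy
    ... | no x≢a | _ = inj₂ (other-σ-preserves x y σxy λ x≡a _ → x≢a x≡a)
    ... | yes _ | no y≢b = inj₂ (other-σ-preserves x y σxy λ _ y≡b → y≢b y≡b)
    Cong-preserves Cong.refl = inj₂ (refl , λ _ → (λ h → h) , (λ h → h))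
    Cong-preserves (Cong.sym c) with Cong-preserves c
    ... | inj₁ r = inj₁ r
    ... | inj₂ (eq , iff) = inj₂ (sym eq , λ ⟦y⟧ → let (to , from) = iff (trans eq ⟦y⟧) in from , to)
    Cong-preserves (Cong.trans c₁ c₂) with Cong-preserves c₁ | Cong-preserves c₂
    ... | inj₁ r | _ = inj₁ r
    ... | inj₂ _ | inj₁ r = inj₁ r
    ... | inj₂ (eq₁ , iff₁) | inj₂ (eq₂ , iff₂) = inj₂ (trans eq₁ eq₂ , λ ⟦x⟧ →
          let (to₁ , from₁) = iff₁ ⟦x⟧ ; (to₂ , from₂) = iff₂ (trans (sym eq₁) ⟦x⟧)
          in (λ h → to₂ (to₁ h)) , (λ h → from₁ (from₂ h)))
    Cong-preserves (add {x} {y} c c′) with Cong-preserves c′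
    ... | inj₁ r = inj₁ r
    ... | inj₂ (eq , iff) = inj₂ (eq′ , λ ⟦x⊕c⟧ → by-support ⟦x⊕c⟧ (≡𝟘⊎supp c))
      where
        eq′ : ⟦ x ⊕ c ⟧ ≡ ⟦ y ⊕ c ⟧
        eq′ = trans (⟦⟧-⊕ x c) (trans (cong (_+ ⟦ c ⟧) eq) (sym (⟦⟧-⊕ y c)))
        by-support : ⟦ x ⊕ c ⟧ ≡ s → c ≡ 𝟘 ⊎ ∃ (_∈-supp c) →
          ((x ⊕ c) ∼[ s ] b → (y ⊕ c) ∼[ s ] b) × ((y ⊕ c) ∼[ s ] b → (x ⊕ c) ∼[ s ] b)
        by-support ⟦x⊕c⟧ (inj₁ refl) rewrite ⊕-identityʳ x | ⊕-identityʳ y = iff ⟦x⊕c⟧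
        by-support ⟦x⊕c⟧ (inj₂ (i , i∈c)) =
          let x∼y = subst (λ t → (x ⊕ c) ∼[ t ] (y ⊕ c)) ⟦x⊕c⟧ (shared-∼ x y c i∈c)
          in (λ x∼b → ∼-trans ⟦x⊕c⟧ (∼-sym x∼y) x∼b) , (λ y∼b → ∼-trans (trans (sym eq′) ⟦x⊕c⟧) x∼y y∼b)

    ρ-pair-in-presentation : IsPresentation ⟦_⟧ σ → σ a b
    ρ-pair-in-presentation σ-pres with Cong-preserves (proj₂ (σ-pres a b) (proj₁ a-least))
    ... | inj₁ σab = σab
    ... | inj₂ (⟦a⟧ , iff) with ≡𝟘⊎supp b
    ...   | inj₁ refl = ⊥-elim (a≢b (dot≡0⇒𝟘 g g>0 a (trans ⟦a⟧ (dot-𝟘 g))))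
    ...   | inj₂ (i , i∈b) = ⊥-elim (a≁b (proj₂ (iff ⟦a⟧) (∼-refl b i∈b)))

  isMinimalPresentation : IsMinimalPresentation ⟦_⟧ ρ
  isMinimalPresentation = isPresentation , λ σ σ⊆ρ σ-pres a b ρab → ρ-pair-in-presentation σ σ⊆ρ ρab σ-pres

-- Apéry functions

≡-mod⇒+* : ∀ m .{{_ : NonZero m}} {a b} → a ≤ b → a % m ≡ b % m → ∃ λ t → b ≡ a + t * m
≡-mod⇒+* m {a} {b} a≤b a≡b = b / m ∸ a / m , (begin
  b                                         ≡⟨ eb ⟩
  b % m + b / m * m                         ≡⟨ cong (λ t → b % m + t * m) (m+[n∸m]≡n qa≤qb) ⟨
  b % m + (a / m + (b / m ∸ a / m)) * m     ≡⟨ cong (b % m +_) (*-distribʳ-+ m (a / m) _) ⟩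
  b % m + (a / m * m + (b / m ∸ a / m) * m) ≡⟨ +-assoc (b % m) _ _ ⟨
  b % m + a / m * m + (b / m ∸ a / m) * m   ≡⟨ cong (λ r → r + a / m * m + (b / m ∸ a / m) * m) a≡b ⟨
  a % m + a / m * m + (b / m ∸ a / m) * m   ≡⟨ cong (_+ (b / m ∸ a / m) * m) ea ⟨
  a + (b / m ∸ a / m) * m                   ∎)
  where
    open ≡-Reasoning
    ea = m≡m%n+[m/n]*n a m
    eb = m≡m%n+[m/n]*n b m
    qa≤qb : a / m ≤ b / m
    qa≤qb = *-cancelʳ-≤ (a / m) (b / m) m (+-cancelˡ-≤ (b % m) _ _
              (subst (_≤ b % m + b / m * m) (trans ea (cong (_+ a / m * m) a≡b)) (subst (a ≤_) eb a≤b)))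

-- A numerical semigroup S with multiplicity m is described by its Apéry function:
-- A r is the least element of S congruent to r, so that s ∈ S ⇔ A s ≤ s.
module AperyFunction (m : ℕ) .{{_ : NonZero m}} (A : ℕ → ℕ)
  (A-%  : ∀ r → A (r % m) ≡ A r)
  (A-≡  : ∀ r → A r % m ≡ r % m)
  (A-0  : A 0 ≡ 0)
  (A-+  : ∀ a b → A (a + b) ≤ A a + A b) where

  m>0 : 0 < m
  m>0 = >-nonZero⁻¹ m

  InS : ℕ → Set
  InS s = A s ≤ s

  InAp : ℕ → Set
  InAp s = A s ≡ s

  InAp? : ∀ s → Dec (InAp s)
  InAp? s = A s ≟ s

  A-+*m : ∀ t s → A (t * m + s) ≡ A s
  A-+*m t s = begin
    A (t * m + s)       ≡⟨ A-% (t * m + s) ⟨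
    A ((t * m + s) % m) ≡⟨ cong (λ r → A (r % m)) (+-comm (t * m) s) ⟩
    A ((s + t * m) % m) ≡⟨ cong A ([m+kn]%n≡m%n s t m) ⟩
    A (s % m)           ≡⟨ A-% s ⟩
    A s                 ∎
    where open ≡-Reasoning

  A-idem : ∀ s → A (A s) ≡ A s
  A-idem s = trans (sym (A-% (A s))) (trans (cong A (A-≡ s)) (A-% s))

  A-≡-mod : ∀ {a b} → a % m ≡ b % m → A a ≡ A b
  A-≡-mod {a} {b} eq = trans (sym (A-% a)) (trans (cong A eq) (A-% b))

  InS⇒+*m : ∀ {s} → InS s → ∃ λ t → s ≡ A s + t * m
  InS⇒+*m {s} s∈S = ≡-mod⇒+* m s∈S (A-≡ s)

  InS-0 : InS 0
  InS-0 = ≤-reflexive A-0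

  InS-A : ∀ s → InS (A s)
  InS-A s = ≤-reflexive (A-idem s)

  InS-+ : ∀ {a b} → InS a → InS b → InS (a + b)
  InS-+ {a} {b} a∈S b∈S = ≤-trans (A-+ a b) (+-mono-≤ a∈S b∈S)

  InS-* : ∀ c {a} → InS a → InS (c * a)
  InS-* zero _ = InS-0
  InS-* (suc c) a∈S = InS-+ a∈S (InS-* c a∈S)

  InS-+*m : ∀ t {s} → InS s → InS (t * m + s)
  InS-+*m t {s} s∈S = subst (_≤ t * m + s) (sym (A-+*m t s)) (≤-trans s∈S (m≤n+m s (t * m)))

  InAp⇒¬InS-∸m : ∀ {s} → InAp s → m ≤ s → ¬ InS (s ∸ m)
  InAp⇒¬InS-∸m {s} s∈Ap m≤s s-m∈S = <-irrefl s∈Ap (begin-strict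
    A s     ≡⟨ cong A (m+[n∸m]≡n m≤s) ⟨
    A (m + (s ∸ m)) ≡⟨ cong (λ r → A (r + (s ∸ m))) (*-identityˡ m) ⟨
    A (1 * m + (s ∸ m)) ≡⟨ A-+*m 1 (s ∸ m) ⟩
    A (s ∸ m) ≤⟨ s-m∈S ⟩
    s ∸ m   <⟨ ∸-monoʳ-< m>0 m≤s ⟩
    s       ∎)
    where open ≤-Reasoning

  InAp-summand : ∀ {a b} → InAp (a + b) → InS a → InS b → InAp a
  InAp-summand {a} {b} a+b∈Ap a∈S b∈S with m≤n⇒m<n∨m≡n a∈S
  ... | inj₂ eq = eq
  ... | inj₁ A<a = ⊥-elim (<-irrefl a+b∈Ap (≤-<-trans (A-+ a b) (+-mono-<-≤ A<a b∈S)))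

  InAp-≡-mod : ∀ {a b} → InAp a → InAp b → a % m ≡ b % m → a ≡ b
  InAp-≡-mod {a} {b} a∈Ap b∈Ap eq = trans (sym a∈Ap) (trans (A-≡-mod eq) b∈Ap)

  InAp-≤ : ∀ {a b} → InAp a → InS b → a % m ≡ b % m → a ≤ b
  InAp-≤ {a} {b} a∈Ap b∈S eq = subst (_≤ b) (trans (A-≡-mod (sym eq)) a∈Ap) b∈S

  InS-dot : ∀ {k} (n : Fin k → ℕ) → (∀ i → InS (n i)) → ∀ z → InS (dot n z)
  InS-dot n n∈S [] = InS-0
  InS-dot n n∈S (x ∷ z) = InS-+ (InS-* x (n∈S zero)) (InS-dot (λ i → n (suc i)) (λ i → n∈S (suc i)) z)

-- The Kunz pairs of a face and what they mean in a semigroup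

dot-≡-mod : ∀ m .{{_ : NonZero m}} {k} (a b : Fin k → ℕ) → (∀ i → a i % m ≡ b i % m) → ∀ u → dot a u % m ≡ dot b u % m
dot-≡-mod m a b a≡b [] = refl
dot-≡-mod m a b a≡b (x ∷ u) = begin
  (x * a zero + dot a′ u) % m                           ≡⟨ %-distribˡ-+ (x * a zero) (dot a′ u) m ⟩
  ((x * a zero) % m + dot a′ u % m) % m                 ≡⟨ cong₂ (λ s t → (s + t) % m) (%-distribˡ-* x (a zero) m)
                                                             (dot-≡-mod m a′ b′ (λ i → a≡b (suc i)) u) ⟩
  ((x % m * (a zero % m)) % m + dot b′ u % m) % m       ≡⟨ cong (λ s → ((x % m * s) % m + dot b′ u % m) % m) (a≡b zero) ⟩
  ((x % m * (b zero % m)) % m + dot b′ u % m) % m       ≡⟨ cong (λ s → (s + dot b′ u % m) % m) (%-distribˡ-* x (b zero) m) ⟨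
  ((x * b zero) % m + dot b′ u % m) % m                 ≡⟨ %-distribˡ-+ (x * b zero) (dot b′ u) m ⟨
  (x * b zero + dot b′ u) % m                           ∎
  where
    open ≡-Reasoning
    a′ = λ i → a (suc i)
    b′ = λ i → b (suc i)

-- The ingredients of ρ_F.  Factorizations u ∈ ℕ^k use only the atoms, whose residues are q; a pair of
-- residues is "tight" when the corresponding Kunz inequality holds with equality on the face.
module KunzPairs (m : ℕ) .{{_ : NonZero m}} (k : ℕ) (q : Fin k → ℕ) (TightPair : ℕ → ℕ → Set) where

  res : Vec ℕ k → ℕ
  res u = dot q u % m

  -- Factorizations of Apéry elements: each partial sum stays tight.
  data IsApéry : Vec ℕ k → Set where
    𝟘-Apéry : IsApéry 𝟘
    ⊕e-Apéry : ∀ {u i} → IsApéry u → TightPair (res u) (q i) → IsApéry (u ⊕ e[ i ])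

  IsLeastApéry : ℕ → Vec ℕ k → Set
  IsLeastApéry r = IsLeast _≤L_ (λ v → IsApéry v × res v ≡ r)

  ApéryLinked : ℕ → Fin (suc k) → Fin (suc k) → Set
  ApéryLinked r i j = ∃ λ v → IsApéry v × res v ≡ r × i ∈-supp (0 ∷ v) × j ∈-supp (0 ∷ v)

  ClassLeastInAp : Vec ℕ k → Set
  ClassLeastInAp w =
    IsApéry w × ¬ IsLeastApéry (res w) w ×
    (∀ v → IsApéry v → res v ≡ res w → Connected (ApéryLinked (res w)) (0 ∷ v) (0 ∷ w) → w ≤L v)

  -- The R-class of w when the value of w is not an Apéry element.
  data SwapClass (w : Vec ℕ k) : Vec ℕ k → Set where
    itself : SwapClass w w
    swap : ∀ {v u i} → SwapClass w (v ⊕ e[ i ]) → IsApéry v → IsApéry u → res u ≡ res v → SwapClass w (u ⊕ e[ i ])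

  ApéryBelow : Vec ℕ k → Set
  ApéryBelow v = ∀ v′ i → v ≡ v′ ⊕ e[ i ] → IsApéry v′

  ClassLeastOutsideAp : Vec ℕ k → Set
  ClassLeastOutsideAp w = ¬ IsApéry w × (∀ v → SwapClass w v → ApéryBelow v × w ≤L v)

  KunzPair : Vec ℕ k → Vec ℕ k → Set
  KunzPair u w = IsLeastApéry (res w) u × (ClassLeastOutsideAp w ⊎ ClassLeastInAp w)

module KunzSemantics (m : ℕ) .{{_ : NonZero m}} (A : ℕ → ℕ)
  (A-%  : ∀ r → A (r % m) ≡ A r)
  (A-≡  : ∀ r → A r % m ≡ r % m)
  (A-0  : A 0 ≡ 0)
  (A-+  : ∀ a b → A (a + b) ≤ A a + A b)
  (k : ℕ) (n : Fin k → ℕ) (n∈Ap : ∀ i → A (n i) ≡ n i) (n>0 : ∀ i → 0 < n i)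
  (Ap-split : ∀ s → A s ≡ s → 0 < s →
    (∃ λ c → ∃ λ d → c + d ≡ s × 0 < c × 0 < d × A c ≡ c × A d ≡ d) ⊎ (∃ λ i → n i ≡ s))
  (q : Fin k → ℕ) (n≡q : ∀ i → n i % m ≡ q i) (q<m : ∀ i → q i < m)
  (TightPair : ℕ → ℕ → Set)
  (TightPair⇔ : ∀ r₁ r₂ → r₁ < m → r₂ < m →
    (TightPair r₁ r₂ → A r₁ + A r₂ ≡ A (r₁ + r₂)) × (A r₁ + A r₂ ≡ A (r₁ + r₂) → TightPair r₁ r₂))
  where

  open AperyFunction m A A-% A-≡ A-0 A-+
  open KunzPairs m k q TightPair

  g : Fin (suc k) → ℕ
  g zero = m
  g (suc i) = n i

  g>0 : ∀ i → 0 < g i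
  g>0 zero = m>0
  g>0 (suc i) = n>0 i

  open LeastPresentation g g>0 _≤O_ ≤O-antisym ≤O-least public

  InAp⇒dot : ∀ s → InAp s → ∃ λ u → dot n u ≡ s
  InAp⇒dot = <-rec _ factor
    where
      factor : ∀ s → (∀ {s′} → s′ < s → InAp s′ → ∃ λ u → dot n u ≡ s′) → InAp s → ∃ λ u → dot n u ≡ s
      factor zero IH _ = 𝟘 , dot-𝟘 n
      factor (suc s) IH s∈Ap with Ap-split (suc s) s∈Ap (s≤s z≤n)
      ... | inj₂ (i , nᵢ≡s) = e[ i ] , trans (dot-e n i) nᵢ≡s
      ... | inj₁ (c , d , c+d≡s , c>0 , d>0 , c∈Ap , d∈Ap)
        with IH (subst (c <_) c+d≡s (m<m+n c d>0)) c∈Ap | IH (subst (d <_) c+d≡s (m<n+m d c>0)) d∈Ap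
      ... | u , ⟦u⟧ | v , ⟦v⟧ = u ⊕ v , trans (dot-⊕ n u v) (trans (cong₂ _+_ ⟦u⟧ ⟦v⟧) c+d≡s)

  ¬InAp⇒fact-with-m : ∀ {s} → InS s → ¬ InAp s → ∃ λ z → ⟦ z ⟧ ≡ s × zero ∈-supp z
  ¬InAp⇒fact-with-m {s} s∈S s∉Ap with InS⇒+*m s∈S | InAp⇒dot (A s) (A-idem s)
  ... | zero , eq | _ = ⊥-elim (s∉Ap (sym (trans eq (+-identityʳ _))))
  ... | suc t , eq | u , ⟦u⟧ =
    suc t ∷ u , trans (cong (suc t * m +_) ⟦u⟧) (trans (+-comm _ (A s)) (sym eq)) , s≤s z≤n

  n∈S : ∀ i → InS (n i)
  n∈S i = ≤-reflexive (n∈Ap i)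

  dot∈S : ∀ u → InS (dot n u)
  dot∈S = InS-dot n n∈S

  ⟦⟧∈S : ∀ z → InS ⟦ z ⟧
  ⟦⟧∈S (t ∷ u) = InS-+*m t (dot∈S u)

  res≡ : ∀ u → res u ≡ dot n u % m
  res≡ u = sym (dot-≡-mod m n q (λ i → trans (n≡q i) (sym (m<n⇒m%n≡m (q<m i)))) u)

  A-q : ∀ i → A (q i) ≡ n i
  A-q i = trans (cong A (sym (n≡q i))) (trans (A-% (n i)) (n∈Ap i))

  A-res : ∀ u → A (res u) ≡ A (dot n u)
  A-res u = trans (cong A (res≡ u)) (A-% _)

  A-res+q : ∀ u i → A (res u + q i) ≡ A (dot n u + n i)
  A-res+q u i = A-≡-mod (begin
    (res u + q i) % m                 ≡⟨ cong₂ (λ a b → (a + b) % m) (res≡ u) (sym (n≡q i)) ⟩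
    (dot n u % m + n i % m) % m       ≡⟨ %-distribˡ-+ (dot n u) (n i) m ⟨
    (dot n u + n i) % m               ∎)
    where open ≡-Reasoning

  TightPair⇒InAp : ∀ {u i} → InAp (dot n u) → TightPair (res u) (q i) → InAp (dot n u + n i)
  TightPair⇒InAp {u} {i} u∈Ap tight = begin
    A (dot n u + n i)     ≡⟨ A-res+q u i ⟨
    A (res u + q i)       ≡⟨ proj₁ (TightPair⇔ _ _ (m%n<n _ m) (q<m i)) tight ⟨
    A (res u) + A (q i)   ≡⟨ cong₂ _+_ (trans (A-res u) u∈Ap) (A-q i) ⟩
    dot n u + n i         ∎
    where open ≡-Reasoning

  InAp⇒TightPair : ∀ {u i} → InAp (dot n u + n i) → TightPair (res u) (q i)
  InAp⇒TightPair {u} {i} sum∈Ap = proj₂ (TightPair⇔ _ _ (m%n<n _ m) (q<m i)) (begin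
    A (res u) + A (q i)   ≡⟨ cong₂ _+_ (trans (A-res u) (InAp-summand sum∈Ap (dot∈S u) (n∈S i))) (A-q i) ⟩
    dot n u + n i         ≡⟨ sum∈Ap ⟨
    A (dot n u + n i)     ≡⟨ A-res+q u i ⟨
    A (res u + q i)       ∎)
    where open ≡-Reasoning

  IsApéry⇒InAp : ∀ {u} → IsApéry u → InAp (dot n u)
  IsApéry⇒InAp 𝟘-Apéry rewrite dot-𝟘 n = A-0
  IsApéry⇒InAp (⊕e-Apéry {u} {i} u-Apéry tight) =
    subst InAp (sym (dot-⊕e n u i)) (TightPair⇒InAp {u} (IsApéry⇒InAp u-Apéry) tight)

  InAp⇒IsApéry : ∀ u → InAp (dot n u) → IsApéry u
  InAp⇒IsApéry u = <-rec (λ s → ∀ u → dot n u ≡ s → InAp s → IsApéry u) peel (dot n u) u refl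
    where
      peel : ∀ s → (∀ {s′} → s′ < s → ∀ u → dot n u ≡ s′ → InAp s′ → IsApéry u) →
             ∀ u → dot n u ≡ s → InAp s → IsApéry u
      peel s IH u refl u∈Ap with ≡𝟘⊎supp u
      ... | inj₁ refl = 𝟘-Apéry
      ... | inj₂ (i , i∈u) with ∈-supp⇒⊕e u i∈u
      ... | u′ , refl = ⊕e-Apéry (IH u′<u u′ refl (InAp-summand sum∈Ap (dot∈S u′) (n∈S i))) (InAp⇒TightPair {u′} sum∈Ap)
        where
          sum∈Ap : InAp (dot n u′ + n i)
          sum∈Ap = subst InAp (dot-⊕e n u′ i) u∈Ap
          u′<u : dot n u′ < dot n (u′ ⊕ e[ i ])
          u′<u = subst (dot n u′ <_) (sym (dot-⊕e n u′ i)) (m<m+n _ (n>0 i))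

  IsApéry? : ∀ u → Dec (IsApéry u)
  IsApéry? u with InAp? (dot n u)
  ... | yes u∈Ap = yes (InAp⇒IsApéry u u∈Ap)
  ... | no u∉Ap = no λ u-Apéry → u∉Ap (IsApéry⇒InAp u-Apéry)

  res-≡⇒dot-≡ : ∀ {u v} → IsApéry u → IsApéry v → res u ≡ res v → dot n u ≡ dot n v
  res-≡⇒dot-≡ {u} {v} u-Apéry v-Apéry eq =
    InAp-≡-mod (IsApéry⇒InAp u-Apéry) (IsApéry⇒InAp v-Apéry) (trans (sym (res≡ u)) (trans eq (res≡ v)))

  dot-≡⇒res-≡ : ∀ {u v} → dot n u ≡ dot n v → res u ≡ res v
  dot-≡⇒res-≡ {u} {v} eq = trans (res≡ u) (trans (cong (_% m) eq) (sym (res≡ v)))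

  InAp-fact⇒IsApéry : ∀ {s} → InAp s → ∀ z → ⟦ z ⟧ ≡ s → ∃ λ v → z ≡ 0 ∷ v × IsApéry v
  InAp-fact⇒IsApéry s∈Ap (zero ∷ v) refl = v , refl , InAp⇒IsApéry v s∈Ap
  InAp-fact⇒IsApéry s∈Ap (suc t ∷ v) refl = ⊥-elim (InAp⇒¬InS-∸m s∈Ap m≤s (subst InS (sym s∸m) (⟦⟧∈S (t ∷ v))))
    where
      m≤s : m ≤ ⟦ suc t ∷ v ⟧
      m≤s = ≤-trans (m≤m+n m (t * m)) (m≤m+n (m + t * m) (dot n v))
      s∸m : ⟦ suc t ∷ v ⟧ ∸ m ≡ ⟦ t ∷ v ⟧
      s∸m = trans (cong (_∸ m) (+-assoc m (t * m) (dot n v))) (m+n∸m≡n m _)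

  leastFact-from : ∀ t u s → t * m + dot n u ≡ s → IsLeastApéry (s % m) u → IsLeastFact s (t ∷ u)
  leastFact-from t u s eq ((u-Apéry , res-u) , u-least) = eq , least
    where
      u∈Ap = IsApéry⇒InAp u-Apéry
      least : ∀ z → ⟦ z ⟧ ≡ s → (t ∷ u) ≤O z
      least (t′ ∷ v) eq′ with m≤n⇒m<n∨m≡n t′≤t
        where
          v≡s : dot n v % m ≡ s % m
          v≡s = trans (sym ([m+kn]%n≡m%n (dot n v) t′ m)) (cong (_% m) (trans (+-comm (dot n v) (t′ * m)) eq′))
          u≤v : dot n u ≤ dot n v
          u≤v = InAp-≤ u∈Ap (dot∈S v) (trans (sym (res≡ u)) (trans res-u (sym v≡s)))
          t′≤t : t′ ≤ t
          t′≤t = *-cancelʳ-≤ t′ t m (+-cancelʳ-≤ (dot n v) _ _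
                   (subst (_≤ t * m + dot n v) (sym eq′) (subst (_≤ t * m + dot n v) eq (+-monoʳ-≤ (t * m) u≤v))))
      ... | inj₁ t′<t = inj₁ t′<t
      ... | inj₂ refl =
        inj₂ (refl , u-least v (InAp⇒IsApéry v (subst InAp (sym v≡u) u∈Ap) , trans (dot-≡⇒res-≡ {v} {u} v≡u) res-u))
        where
          v≡u : dot n v ≡ dot n u
          v≡u = +-cancelˡ-≡ (t * m) _ _ (trans eq′ (sym eq))

  leastApéry-exists : ∀ s → InS s → ∃ λ t → ∃ λ u → t * m + dot n u ≡ s × IsLeastApéry (s % m) u
  leastApéry-exists s s∈S with InAp⇒dot (A s) (A-idem s)
  ... | v , ⟦v⟧ with ≤L-least (λ v → IsApéry? v ×-dec (res v ≟ s % m)) bounded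
                      (v , InAp⇒IsApéry v v∈Ap , trans (res≡ v) (trans (cong (_% m) ⟦v⟧) (A-≡ s)))
    where
      v∈Ap : InAp (dot n v)
      v∈Ap = subst InAp (sym ⟦v⟧) (A-idem s)
      dot≡A : ∀ v → IsApéry v × res v ≡ s % m → dot n v ≡ A s
      dot≡A v (v-Apéry , res-v) =
        InAp-≡-mod (IsApéry⇒InAp v-Apéry) (A-idem s) (trans (sym (res≡ v)) (trans res-v (sym (A-≡ s))))
      bounded : BoundedBy (A s) (λ v → IsApéry v × res v ≡ s % m)
      bounded v p i = subst (lookup v i ≤_) (dot≡A v p) (lookup≤dot n n>0 v i)
  ... | u , u-least@((u-Apéry , res-u) , _) with InS⇒+*m s∈S
  ... | t , s≡ = t , u , trans (cong (t * m +_) u≡A) (trans (+-comm (t * m) (A s)) (sym s≡)) , u-least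
    where
      u≡A : dot n u ≡ A s
      u≡A = InAp-≡-mod (IsApéry⇒InAp u-Apéry) (A-idem s) (trans (sym (res≡ u)) (trans res-u (sym (A-≡ s))))

  Linked⇒ApéryLinked : ∀ {w i j} → IsApéry w → Linked (dot n w) i j → ApéryLinked (res w) i j
  Linked⇒ApéryLinked {w} w-Apéry (z , ⟦z⟧ , i∈z , j∈z) with InAp-fact⇒IsApéry (IsApéry⇒InAp w-Apéry) z ⟦z⟧
  ... | v , refl , v-Apéry = v , v-Apéry , dot-≡⇒res-≡ {v} {w} ⟦z⟧ , i∈z , j∈z

  ApéryLinked⇒Linked : ∀ {w i j} → IsApéry w → ApéryLinked (res w) i j → Linked (dot n w) i j
  ApéryLinked⇒Linked w-Apéry (v , v-Apéry , res-v , i∈v , j∈v) = 0 ∷ v , res-≡⇒dot-≡ v-Apéry w-Apéry res-v , i∈v , j∈v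

  module Class (w : Vec ℕ k) where

    private
      s = dot n w

    ClassLeastInAp⇒IsClassLeast : ClassLeastInAp w → IsClassLeast s (0 ∷ w)
    ClassLeastInAp⇒IsClassLeast (w-Apéry , _ , w-least) = refl , least
      where
        least : ∀ z → ⟦ z ⟧ ≡ s → z ∼[ s ] (0 ∷ w) → (0 ∷ w) ≤O z
        least z ⟦z⟧ z∼w with InAp-fact⇒IsApéry (IsApéry⇒InAp w-Apéry) z ⟦z⟧
        ... | v , refl , v-Apéry =
          inj₂ (refl , w-least v v-Apéry (dot-≡⇒res-≡ {v} {w} ⟦z⟧) (Connected-map (Linked⇒ApéryLinked w-Apéry) z∼w))

    IsClassLeast⇒ClassLeastInAp : IsApéry w → IsClassLeast s (0 ∷ w) → ∀ v → IsApéry v → res v ≡ res w →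
                                   Connected (ApéryLinked (res w)) (0 ∷ v) (0 ∷ w) → w ≤L v
    IsClassLeast⇒ClassLeastInAp w-Apéry (_ , w-least) v v-Apéry res-v v∼w =
      ≤O-cons0⇒≤L (w-least (0 ∷ v) (res-≡⇒dot-≡ v-Apéry w-Apéry res-v) (Connected-map (ApéryLinked⇒Linked w-Apéry) v∼w))

    SwapClass-dot : ∀ {v} → SwapClass w v → dot n v ≡ s
    SwapClass-dot itself = refl
    SwapClass-dot (swap {v} {u} {i} cl v-Apéry u-Apéry res-u) = begin
      dot n (u ⊕ e[ i ]) ≡⟨ dot-⊕e n u i ⟩
      dot n u + n i      ≡⟨ cong (_+ n i) (res-≡⇒dot-≡ u-Apéry v-Apéry res-u) ⟩
      dot n v + n i      ≡⟨ dot-⊕e n v i ⟨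
      dot n (v ⊕ e[ i ]) ≡⟨ SwapClass-dot cl ⟩
      s                  ∎
      where open ≡-Reasoning

    SwapClass⇒∼ : w ≢ 𝟘 → ∀ {v} → SwapClass w v → (0 ∷ v) ∼[ s ] (0 ∷ w)
    SwapClass⇒∼ w≢𝟘 itself with ≡𝟘⊎supp w
    ... | inj₁ w≡𝟘 = ⊥-elim (w≢𝟘 w≡𝟘)
    ... | inj₂ (i , i∈w) = ∼-refl (0 ∷ w) {suc i} i∈w
    SwapClass⇒∼ w≢𝟘 cl′@(swap {v} {u} {i} cl _ _ _) =
      ∼-trans (SwapClass-dot cl)
        (subst (λ s′ → (0 ∷ (u ⊕ e[ i ])) ∼[ s′ ] (0 ∷ (v ⊕ e[ i ]))) (SwapClass-dot cl′) same-atom)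
        (SwapClass⇒∼ w≢𝟘 cl)
      where
        same-atom : (0 ∷ (u ⊕ e[ i ])) ∼[ dot n (u ⊕ e[ i ]) ] (0 ∷ (v ⊕ e[ i ]))
        same-atom = connected {i = suc i} (∈-supp-⊕e u i) (∈-supp-⊕e v i) ε

    module _ (below : ∀ v → SwapClass w v → ApéryBelow v) where

      class-step : ∀ {v j} → SwapClass w v → j ∈-supp (0 ∷ v) →
                   ∀ c → ⟦ c ⟧ ≡ s → j ∈-supp c → ∃ λ v′ → c ≡ 0 ∷ v′ × SwapClass w v′
      class-step {v} {suc j} cl j∈v c ⟦c⟧ j∈c with ∈-supp⇒⊕e v j∈v | ∈-supp⇒⊕e c {suc j} j∈c
      ... | v′ , refl | c′ , refl = swap-in (below _ cl v′ j refl)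
        where
          ⟦c′⟧ : ⟦ c′ ⟧ ≡ dot n v′
          ⟦c′⟧ = +-cancelʳ-≡ (n j) _ _
                   (trans (sym (dot-⊕e g c′ (suc j))) (trans ⟦c⟧ (trans (sym (SwapClass-dot cl)) (dot-⊕e n v′ j))))
          swap-in : IsApéry v′ → ∃ λ v″ → c′ ⊕ e[ suc j ] ≡ 0 ∷ v″ × SwapClass w v″
          swap-in v′-Apéry with InAp-fact⇒IsApéry (IsApéry⇒InAp v′-Apéry) c′ ⟦c′⟧
          ... | u′ , refl , u′-Apéry = u′ ⊕ e[ j ] , refl , swap cl v′-Apéry u′-Apéry (dot-≡⇒res-≡ {u′} {v′} ⟦c′⟧)

      path-in-class : ∀ {i j} → Star (Linked s) j i → ∀ {v} → SwapClass w v → j ∈-supp (0 ∷ v) →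
                      ∃ λ v → SwapClass w v × i ∈-supp (0 ∷ v)
      path-in-class ε cl j∈v = _ , cl , j∈v
      path-in-class ((c , ⟦c⟧ , j∈c , l∈c) ◅ p) cl j∈v with class-step cl j∈v c ⟦c⟧ j∈c
      ... | _ , refl , cl′ = path-in-class p cl′ l∈c

      ∼⇒SwapClass : ∀ z → ⟦ z ⟧ ≡ s → z ∼[ s ] (0 ∷ w) → ∃ λ v → z ≡ 0 ∷ v × SwapClass w v
      ∼⇒SwapClass z ⟦z⟧ (connected i∈z j∈w p) with path-in-class (Star.reverse Linked-sym p) itself j∈w
      ... | v , cl , i∈v = class-step cl i∈v z ⟦z⟧ i∈z

    ClassLeastOutsideAp⇒IsClassLeast : ClassLeastOutsideAp w → IsClassLeast s (0 ∷ w)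
    ClassLeastOutsideAp⇒IsClassLeast (_ , class) = refl , least
      where
        least : ∀ z → ⟦ z ⟧ ≡ s → z ∼[ s ] (0 ∷ w) → (0 ∷ w) ≤O z
        least z ⟦z⟧ z∼w with ∼⇒SwapClass (λ v cl → proj₁ (class v cl)) z ⟦z⟧ z∼w
        ... | v , refl , cl = inj₂ (refl , proj₂ (class v cl))

    module _ {t u} (ρab : ρ (t ∷ u) (0 ∷ w)) where

      private
        a-least = proj₁ ρab
        b-classLeast = proj₁ (proj₂ ρab)
        a≢b = proj₂ (proj₂ ρab)
        a≁b = least-not-∼-other-class-least a-least b-classLeast a≢b

      ρ⇒ClassLeastInAp : InAp s → ClassLeastInAp w
      ρ⇒ClassLeastInAp s∈Ap = w-Apéry , not-least , IsClassLeast⇒ClassLeastInAp w-Apéry b-classLeast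
        where
          w-Apéry = InAp⇒IsApéry w s∈Ap
          not-least : ¬ IsLeastApéry (res w) w
          not-least (_ , w-least) with InAp-fact⇒IsApéry s∈Ap (t ∷ u) (proj₁ a-least)
          ... | _ , refl , u-Apéry = a≢b (≤O-antisym _ _ (proj₂ a-least (0 ∷ w) refl)
                                       (inj₂ (refl , w-least u (u-Apéry , dot-≡⇒res-≡ {u} {w} (proj₁ a-least)))))

      t>0 : ¬ InAp s → 0 < t
      t>0 s∉Ap with ¬InAp⇒fact-with-m (dot∈S w) s∉Ap
      ... | z₀ ∷ z , ⟦z⟧ , z₀>0 with proj₂ a-least (z₀ ∷ z) ⟦z⟧
      ... | inj₁ z₀<t = ≤-<-trans z≤n z₀<t
      ... | inj₂ (refl , _) = z₀>0

      ρ⇒ClassLeastOutsideAp : ¬ InAp s → ClassLeastOutsideAp w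
      ρ⇒ClassLeastOutsideAp s∉Ap = (λ w-Apéry → s∉Ap (IsApéry⇒InAp w-Apéry)) , λ v cl →
        below v cl , ≤O-cons0⇒≤L (proj₂ b-classLeast (0 ∷ v) (SwapClass-dot cl) (SwapClass⇒∼ w≢𝟘 cl))
        where
          w≢𝟘 : w ≢ 𝟘
          w≢𝟘 refl = s∉Ap (subst (λ s′ → A s′ ≡ s′) (sym (dot-𝟘 n)) A-0)
          m-link : ∀ v′ i → dot n (v′ ⊕ e[ i ]) ≡ s → ¬ IsApéry v′ → Linked s zero (suc i)
          m-link v′ i ⟦v⟧ v′-not with ¬InAp⇒fact-with-m (dot∈S v′) (λ v′∈Ap → v′-not (InAp⇒IsApéry v′ v′∈Ap))
          ... | z , ⟦z⟧ , 0∈z = z ⊕ e[ suc i ] ,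
            trans (dot-⊕e g z (suc i)) (trans (cong (_+ n i) ⟦z⟧) (trans (sym (dot-⊕e n v′ i)) ⟦v⟧)) ,
            ∈-supp-⊕ˡ z e[ suc i ] 0∈z , ∈-supp-⊕e z (suc i)
          below : ∀ v → SwapClass w v → ApéryBelow v
          -- Otherwise m and the atom i are linked, joining the class of b to that of a.
          below v cl v′ i refl with IsApéry? v′
          ... | yes v′-Apéry = v′-Apéry
          ... | no v′-not = ⊥-elim (a≁b (∼-trans (SwapClass-dot cl) a∼v (SwapClass⇒∼ w≢𝟘 cl)))
            where
              a∼v : (t ∷ u) ∼[ s ] (0 ∷ (v′ ⊕ e[ i ]))
              a∼v = connected {i = zero} (t>0 s∉Ap) (∈-supp-⊕e v′ i) (m-link v′ i (SwapClass-dot cl) v′-not ◅ ε)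

  ρ-Kunz : Vec ℕ (suc k) → Vec ℕ (suc k) → Set
  ρ-Kunz a b = ∃ λ t → ∃ λ u → ∃ λ w → a ≡ t ∷ u × b ≡ 0 ∷ w × t * m + dot n u ≡ dot n w × KunzPair u w

  ρ⇒ρ-Kunz : ∀ a b → ρ a b → ρ-Kunz a b
  ρ⇒ρ-Kunz (t ∷ u) (suc b₀ ∷ w) (a-least , b-classLeast , a≢b) =
    ⊥-elim (least-not-∼-other-class-least a-least b-classLeast a≢b (connected {i = zero} t>0 (s≤s z≤n) ε))
    where
      t>0 : 0 < t
      t>0 with proj₂ a-least (suc b₀ ∷ w) refl
      ... | inj₁ b₀<t = ≤-<-trans z≤n b₀<t
      ... | inj₂ (refl , _) = s≤s z≤n
  ρ⇒ρ-Kunz (t ∷ u) (0 ∷ w) ρab with leastApéry-exists (dot n w) (dot∈S w)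
  ... | t′ , u′ , eq , u′-least with IsLeast-unique ≤O-antisym (proj₁ ρab) (leastFact-from t′ u′ _ eq u′-least)
  ... | refl = t , u , w , refl , refl , eq , subst (λ r → IsLeastApéry r u) (sym (res≡ w)) u′-least ,
               class (InAp? (dot n w))
    where
      open Class w
      class : Dec (InAp (dot n w)) → ClassLeastOutsideAp w ⊎ ClassLeastInAp w
      class (yes s∈Ap) = inj₂ (ρ⇒ClassLeastInAp ρab s∈Ap)
      class (no s∉Ap) = inj₁ (ρ⇒ClassLeastOutsideAp ρab s∉Ap)

  ρ-Kunz⇒ρ : ∀ a b → ρ-Kunz a b → ρ a b
  ρ-Kunz⇒ρ _ _ (t , u , w , refl , refl , eq , u-least , class) =
    leastFact-from t u (dot n w) eq (subst (λ r → IsLeastApéry r u) (res≡ w) u-least) ,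
    classLeast class , distinct class
    where
      open Class w
      classLeast : ClassLeastOutsideAp w ⊎ ClassLeastInAp w → IsClassLeast (dot n w) (0 ∷ w)
      classLeast (inj₁ outside) = ClassLeastOutsideAp⇒IsClassLeast outside
      classLeast (inj₂ inside) = ClassLeastInAp⇒IsClassLeast inside
      distinct : ClassLeastOutsideAp w ⊎ ClassLeastInAp w → t ∷ u ≢ 0 ∷ w
      distinct (inj₁ (w-not-Apéry , _)) refl = w-not-Apéry (proj₁ (proj₁ u-least))
      distinct (inj₂ (_ , w-not-least , _)) refl = w-not-least u-least

  ρ-Kunz-isMinimalPresentation : IsMinimalPresentation ⟦_⟧ ρ-Kunz
  ρ-Kunz-isMinimalPresentation = IsMinimalPresentation-resp (λ _ → refl) ρ⇒ρ-Kunz ρ-Kunz⇒ρ isMinimalPresentation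

-- Rational affine functions

suc<⇒<∸1 : ∀ {r n} → suc r < n → r < n ∸ 1
suc<⇒<∸1 {n = suc n} (s≤s r<n) = r<n

ℚof≡mkℚ : ∀ n → ℚof n ≡ mkℚ (ℤ.+ n) 0 (coprime-sym (1-coprimeTo n))
ℚof≡mkℚ n = ℚ.normalize-coprime (coprime-sym (1-coprimeTo n))

ℚof-injective : ∀ {a b} → ℚof a ≡ ℚof b → a ≡ b
ℚof-injective {a} {b} eq rewrite ℚof≡mkℚ a | ℚof≡mkℚ b = ℤ.+-injective (cong ↥_ eq)

ℚof-+ : ∀ a b → ℚof (a + b) ≡ ℚof a ℚ.+ ℚof b
ℚof-+ a b rewrite ℚof≡mkℚ a | ℚof≡mkℚ b | ℚof≡mkℚ (a + b) =
  ℚ.toℚᵘ-injective (ℚᵘ.≃-trans (ℚᵘ.*≡* eq)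
    (ℚᵘ.≃-sym (ℚ.toℚᵘ-homo-+ (mkℚ (ℤ.+ a) 0 (coprime-sym (1-coprimeTo a))) (mkℚ (ℤ.+ b) 0 (coprime-sym (1-coprimeTo b))))))
  where
    eq : ℤ.+ (a + b) ℤ.* ℤ.+ 1 ≡ (ℤ.+ a ℤ.* ℤ.+ 1 ℤ.+ ℤ.+ b ℤ.* ℤ.+ 1) ℤ.* ℤ.+ 1
    eq rewrite ℤ.*-identityʳ (ℤ.+ a) | ℤ.*-identityʳ (ℤ.+ b) = cong (ℤ._* ℤ.+ 1) (ℤ.pos-+ a b)

ℚof-* : ∀ a b → ℚof (a * b) ≡ ℚof a ℚ.* ℚof b
ℚof-* a b rewrite ℚof≡mkℚ a | ℚof≡mkℚ b | ℚof≡mkℚ (a * b) =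
  ℚ.toℚᵘ-injective (ℚᵘ.≃-trans (ℚᵘ.*≡* (cong (ℤ._* ℤ.+ 1) (ℤ.pos-* a b)))
    (ℚᵘ.≃-sym (ℚ.toℚᵘ-homo-* (mkℚ (ℤ.+ a) 0 (coprime-sym (1-coprimeTo a))) (mkℚ (ℤ.+ b) 0 (coprime-sym (1-coprimeTo b))))))

ℚof-nonZero : ∀ m .{{_ : NonZero m}} → ℚ.NonZero (ℚof m)
ℚof-nonZero m = ℚ.≢-nonZero λ eq → ≢-nonZero⁻¹ m (ℚof-injective {m} {0} eq)

ℚof-*-cancelˡ : ∀ m .{{_ : NonZero m}} {X Y} → ℚof m ℚ.* X ≡ ℚof m ℚ.* Y → X ≡ Y
ℚof-*-cancelˡ m {X} {Y} eq = begin
  X                          ≡⟨ ℚ.*-identityˡ X ⟨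
  1ℚ ℚ.* X                   ≡⟨ cong (ℚ._* X) (ℚ.*-inverseˡ M) ⟨
  (ℚ.1/ M ℚ.* M) ℚ.* X       ≡⟨ ℚ.*-assoc (ℚ.1/ M) M X ⟩
  ℚ.1/ M ℚ.* (M ℚ.* X)       ≡⟨ cong (ℚ.1/ M ℚ.*_) eq ⟩
  ℚ.1/ M ℚ.* (M ℚ.* Y)       ≡⟨ ℚ.*-assoc (ℚ.1/ M) M Y ⟨
  (ℚ.1/ M ℚ.* M) ℚ.* Y       ≡⟨ cong (ℚ._* Y) (ℚ.*-inverseˡ M) ⟩
  1ℚ ℚ.* Y                   ≡⟨ ℚ.*-identityˡ Y ⟩
  Y                          ∎
  where
    open ≡-Reasoning
    M = ℚof m
    instance _ = ℚof-nonZero m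

affine-≡⇔ : ∀ m .{{_ : NonZero m}} (X Y : ℚ) (d P Q : ℕ) →
  ℚof m ℚ.* X ℚ.+ ℚof d ≡ ℚof P → ℚof m ℚ.* Y ℚ.+ ℚof d ≡ ℚof Q → (X ≡ Y → P ≡ Q) × (P ≡ Q → X ≡ Y)
affine-≡⇔ m X Y d P Q hX hY =
  (λ { refl → ℚof-injective (trans (sym hX) hY) }) ,
  (λ { refl → ℚof-*-cancelˡ m (∙-cancelʳ (ℚof d) _ _ (trans hX (sym hY))) })

sumℚ-cong : ∀ {N} {f g : Fin N → ℚ} → (∀ j → f j ≡ g j) → sumℚ f ≡ sumℚ g
sumℚ-cong {zero} eq = refl
sumℚ-cong {suc N} eq = cong₂ ℚ._+_ (eq zero) (sumℚ-cong (λ j → eq (suc j)))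

sumℚ-+ : ∀ {N} (f g : Fin N → ℚ) → sumℚ (λ j → f j ℚ.+ g j) ≡ sumℚ f ℚ.+ sumℚ g
sumℚ-+ {zero} f g = refl
sumℚ-+ {suc N} f g rewrite sumℚ-+ (λ j → f (suc j)) (λ j → g (suc j)) =
  solve 4 (λ a b c d → (a :+ b) :+ (c :+ d) := (a :+ c) :+ (b :+ d)) refl
    (f zero) (g zero) (sumℚ (λ j → f (suc j))) (sumℚ (λ j → g (suc j)))

sumℚ-* : ∀ {N} (c : ℚ) (f : Fin N → ℚ) → sumℚ (λ j → c ℚ.* f j) ≡ c ℚ.* sumℚ f
sumℚ-* {zero} c f = sym (ℚ.*-zeroʳ c)
sumℚ-* {suc N} c f rewrite sumℚ-* c (λ j → f (suc j)) = sym (ℚ.*-distribˡ-+ c (f zero) _)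

sumℚ-0* : ∀ {N} (f : Fin N → ℚ) → sumℚ (λ j → 0ℚ ℚ.* f j) ≡ 0ℚ
sumℚ-0* {zero} f = refl
sumℚ-0* {suc N} f rewrite sumℚ-0* (λ j → f (suc j)) = trans (ℚ.+-identityʳ _) (ℚ.*-zeroˡ (f zero))

indicator : ∀ {N} → ℕ → Fin N → ℚ
indicator r j = if toℕ j ≡ᵇ r then 1ℚ else 0ℚ

sumℚ-indicator : ∀ {N} (y : Fin N → ℚ) r (r<N : r < N) → sumℚ (λ j → indicator r j ℚ.* y j) ≡ y (fromℕ< r<N)
sumℚ-indicator {suc N} y zero _ rewrite sumℚ-0* (λ j → y (suc j)) = trans (ℚ.+-identityʳ _) (ℚ.*-identityˡ (y zero))
sumℚ-indicator {suc N} y (suc r) (s≤s r<N) rewrite sumℚ-indicator (λ j → y (suc j)) r r<N =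
  trans (cong (ℚ._+ y (suc (fromℕ< r<N))) (ℚ.*-zeroˡ (y zero))) (ℚ.+-identityˡ _)

module AffineAlgebra (m : ℕ) .{{_ : NonZero m}} where

  M : ℚ
  M = ℚof m

  0ᵃ : Affine m
  0ᵃ = 0ℚ , λ _ → 0ℚ

  infixl 6 _+ᵃ_
  _+ᵃ_ : Affine m → Affine m → Affine m
  (c₁ , v₁) +ᵃ (c₂ , v₂) = c₁ ℚ.+ c₂ , λ j → v₁ j ℚ.+ v₂ j

  infixl 7 _·ᵃ_
  _·ᵃ_ : ℚ → Affine m → Affine m
  c ·ᵃ (c₁ , v₁) = c ℚ.* c₁ , λ j → c ℚ.* v₁ j

  evalAff-0ᵃ : ∀ x → evalAff m 0ᵃ x ≡ 0ℚ
  evalAff-0ᵃ x = trans (ℚ.+-identityˡ _) (sumℚ-0* x)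

  evalAff-+ᵃ : ∀ ℓ₁ ℓ₂ x → evalAff m (ℓ₁ +ᵃ ℓ₂) x ≡ evalAff m ℓ₁ x ℚ.+ evalAff m ℓ₂ x
  evalAff-+ᵃ (c₁ , v₁) (c₂ , v₂) x = begin
    c₁ ℚ.+ c₂ ℚ.+ sumℚ (λ j → (v₁ j ℚ.+ v₂ j) ℚ.* x j)
      ≡⟨ cong (c₁ ℚ.+ c₂ ℚ.+_) (trans (sumℚ-cong (λ j → ℚ.*-distribʳ-+ (x j) (v₁ j) (v₂ j)))
                                      (sumℚ-+ (λ j → v₁ j ℚ.* x j) (λ j → v₂ j ℚ.* x j))) ⟩
    c₁ ℚ.+ c₂ ℚ.+ (S₁ ℚ.+ S₂)
      ≡⟨ solve 4 (λ a b c d → a :+ b :+ (c :+ d) := (a :+ c) :+ (b :+ d)) refl c₁ c₂ S₁ S₂ ⟩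
    c₁ ℚ.+ S₁ ℚ.+ (c₂ ℚ.+ S₂) ∎
    where
      open ≡-Reasoning
      S₁ = sumℚ (λ j → v₁ j ℚ.* x j)
      S₂ = sumℚ (λ j → v₂ j ℚ.* x j)

  evalAff-·ᵃ : ∀ c ℓ x → evalAff m (c ·ᵃ ℓ) x ≡ c ℚ.* evalAff m ℓ x
  evalAff-·ᵃ c (c₁ , v₁) x = begin
    c ℚ.* c₁ ℚ.+ sumℚ (λ j → c ℚ.* v₁ j ℚ.* x j)
      ≡⟨ cong (c ℚ.* c₁ ℚ.+_) (trans (sumℚ-cong (λ j → ℚ.*-assoc c (v₁ j) (x j))) (sumℚ-* c (λ j → v₁ j ℚ.* x j))) ⟩
    c ℚ.* c₁ ℚ.+ c ℚ.* sumℚ (λ j → v₁ j ℚ.* x j)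
      ≡⟨ ℚ.*-distribˡ-+ c c₁ _ ⟨
    c ℚ.* (c₁ ℚ.+ sumℚ (λ j → v₁ j ℚ.* x j)) ∎
    where open ≡-Reasoning

  -- x ↦ x_r + r/m, which takes the value a_r/m at a Kunz tuple.
  apéryAff : ℕ → Affine m
  apéryAff r = ℚof r ℚ.* ℚ.1/ M , indicator (pred r)
    where instance _ = ℚof-nonZero m

  apéryAff-eval : ∀ (x : Pt m) r → 0 < r → r < m → M ℚ.* evalAff m (apéryAff r) x ≡ M ℚ.* coord m x r ℚ.+ ℚof r
  apéryAff-eval x r@(suc r-1) _ r<m = begin
    M ℚ.* (ℚof r ℚ.* ℚ.1/ M ℚ.+ sumℚ (λ j → indicator r-1 j ℚ.* x j))
      ≡⟨ cong (λ s → M ℚ.* (ℚof r ℚ.* ℚ.1/ M ℚ.+ s)) coordinate ⟩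
    M ℚ.* (ℚof r ℚ.* ℚ.1/ M ℚ.+ coord m x r)
      ≡⟨ solve 4 (λ M R I C → M :* (R :* I :+ C) := M :* C :+ R :* (M :* I)) refl M (ℚof r) (ℚ.1/ M) (coord m x r) ⟩
    M ℚ.* coord m x r ℚ.+ ℚof r ℚ.* (M ℚ.* ℚ.1/ M)
      ≡⟨ cong (λ s → M ℚ.* coord m x r ℚ.+ ℚof r ℚ.* s) (ℚ.*-inverseʳ M) ⟩
    M ℚ.* coord m x r ℚ.+ ℚof r ℚ.* 1ℚ
      ≡⟨ cong (M ℚ.* coord m x r ℚ.+_) (ℚ.*-identityʳ (ℚof r)) ⟩
    M ℚ.* coord m x r ℚ.+ ℚof r ∎
    where
      open ≡-Reasoning
      instance _ = ℚof-nonZero m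
      coordinate : sumℚ (λ j → indicator r-1 j ℚ.* x j) ≡ coord m x r
      coordinate with r-1 <? m ∸ 1
      ... | yes r-1<m-1 = sumℚ-indicator x r-1 r-1<m-1
      ... | no r-1≮m-1 = ⊥-elim (r-1≮m-1 (suc<⇒<∸1 r<m))

  -- The affine function ℓ with m ℓ(x) = Σ (w_i − u_i) a_{q_i}.
  differenceAff : ∀ {k} → (Fin k → ℕ) → Vec ℕ k → Vec ℕ k → Affine m
  differenceAff q [] [] = 0ᵃ
  differenceAff q (u₀ ∷ u) (w₀ ∷ w) =
    (ℚof w₀ ℚ.- ℚof u₀) ·ᵃ apéryAff (q zero) +ᵃ differenceAff (λ i → q (suc i)) u w

  differenceAff-eval : ∀ {k} (x : Pt m) (q n : Fin k → ℕ) → (∀ i → M ℚ.* evalAff m (apéryAff (q i)) x ≡ ℚof (n i)) →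
    ∀ u w → M ℚ.* evalAff m (differenceAff q u w) x ℚ.+ ℚof (dot n u) ≡ ℚof (dot n w)
  differenceAff-eval x q n apéry [] [] rewrite evalAff-0ᵃ x = trans (ℚ.+-identityʳ _) (ℚ.*-zeroʳ M)
  differenceAff-eval x q n apéry (u₀ ∷ u) (w₀ ∷ w) = begin
    M ℚ.* evalAff m ((W ℚ.- U) ·ᵃ apéryAff (q zero) +ᵃ differenceAff q′ u w) x ℚ.+ ℚof (u₀ * n zero + dot n′ u)
      ≡⟨ cong₂ (λ a b → M ℚ.* a ℚ.+ b)
           (trans (evalAff-+ᵃ ((W ℚ.- U) ·ᵃ apéryAff (q zero)) (differenceAff q′ u w) x)
                  (cong (ℚ._+ R) (evalAff-·ᵃ (W ℚ.- U) (apéryAff (q zero)) x)))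
           (trans (ℚof-+ (u₀ * n zero) (dot n′ u)) (cong (ℚ._+ Du) (ℚof-* u₀ (n zero)))) ⟩
    M ℚ.* ((W ℚ.- U) ℚ.* E ℚ.+ R) ℚ.+ (U ℚ.* N ℚ.+ Du)
      ≡⟨ solve 7 (λ M W U E R N Du → M :* ((W :- U) :* E :+ R) :+ (U :* N :+ Du)
                                       := (W :- U) :* (M :* E) :+ U :* N :+ (M :* R :+ Du)) refl M W U E R N Du ⟩
    (W ℚ.- U) ℚ.* (M ℚ.* E) ℚ.+ U ℚ.* N ℚ.+ (M ℚ.* R ℚ.+ Du)
      ≡⟨ cong₂ (λ a b → (W ℚ.- U) ℚ.* a ℚ.+ U ℚ.* N ℚ.+ b) (apéry zero)
               (differenceAff-eval x q′ n′ (λ i → apéry (suc i)) u w) ⟩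
    (W ℚ.- U) ℚ.* N ℚ.+ U ℚ.* N ℚ.+ ℚof (dot n′ w)
      ≡⟨ cong (ℚ._+ ℚof (dot n′ w)) (solve 3 (λ W U N → (W :- U) :* N :+ U :* N := W :* N) refl W U N) ⟩
    W ℚ.* N ℚ.+ ℚof (dot n′ w)
      ≡⟨ trans (ℚof-+ (w₀ * n zero) (dot n′ w)) (cong (ℚ._+ ℚof (dot n′ w)) (ℚof-* w₀ (n zero))) ⟨
    ℚof (w₀ * n zero + dot n′ w) ∎
    where
      open ≡-Reasoning
      q′ = λ i → q (suc i)
      n′ = λ i → n (suc i)
      W = ℚof w₀
      U = ℚof u₀
      N = ℚof (n zero)
      E = evalAff m (apéryAff (q zero)) x
      R = evalAff m (differenceAff q′ u w) x
      Du = ℚof (dot n′ u)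

-- Kunz tuples

pairOf : ∀ {m} → Ineq m → ℕ × ℕ
pairOf (lower i j _ _ _) = i , j
pairOf (upper i j _ _ _ _) = i , j

module KunzTuple (m : ℕ) .{{_ : NonZero m}} (S : ℕ → Set) (S-numerical : IsNumSemigroup S)
  (S-multiplicity : HasMultiplicity m S) (x : Pt m) (x-kunz : IsKunzTuple m S x) where

  private
    M = ℚof m
    m>0 = >-nonZero⁻¹ m

  S-0 : S 0
  S-0 = proj₁ S-numerical

  S-+ : ∀ {a b} → S a → S b → S (a + b)
  S-+ {a} {b} = proj₁ (proj₂ S-numerical) a b

  S-*m : ∀ t → S (t * m)
  S-*m zero = S-0
  S-*m (suc t) = S-+ (proj₁ (proj₂ S-multiplicity)) (S-*m t)

  apéry : ℕ → ℕ
  apéry zero = 0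
  apéry (suc r) with r <? m ∸ 1
  ... | yes r<m-1 = proj₁ (x-kunz (fromℕ< r<m-1))
  ... | no _ = 0

  coord-suc : ∀ r (r<m-1 : r < m ∸ 1) → coord m x (suc r) ≡ x (fromℕ< r<m-1)
  coord-suc r r<m-1 with r <? m ∸ 1
  ... | yes _ = refl
  ... | no r≮m-1 = ⊥-elim (r≮m-1 r<m-1)

  apéry-suc : ∀ r (r<m-1 : r < m ∸ 1) → apéry (suc r) ≡ proj₁ (x-kunz (fromℕ< r<m-1))
  apéry-suc r r<m-1 with r <? m ∸ 1
  ... | yes _ = refl
  ... | no r≮m-1 = ⊥-elim (r≮m-1 r<m-1)

  IsApéryAt : ℕ → ℕ → Set
  IsApéryAt r a = a % m ≡ r × S a × (m ≤ a → ¬ S (a ∸ m)) × M ℚ.* coord m x r ℚ.+ ℚof r ≡ ℚof a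

  apéry-spec : ∀ r → r < m → IsApéryAt r (apéry r)
  apéry-spec zero _ = m<n⇒m%n≡m m>0 , S-0 , (λ m≤0 → ⊥-elim (<-irrefl refl (≤-trans m>0 m≤0))) ,
                      trans (ℚ.+-identityʳ (M ℚ.* 0ℚ)) (ℚ.*-zeroʳ M)
  apéry-spec (suc r) r+1<m = subst (IsApéryAt (suc r)) (sym (apéry-suc r r<m-1))
    (trans a≡ (trans (cong (λ t → suc t % m) (toℕ-fromℕ< r<m-1)) (m<n⇒m%n≡m r+1<m)) , a∈S , a-min , coord-a)
    where
      r<m-1 = suc<⇒<∸1 r+1<m
      i = fromℕ< r<m-1
      a = proj₁ (x-kunz i)
      a≡ = proj₁ (proj₂ (proj₂ (x-kunz i)))
      a∈S = proj₁ (proj₂ (proj₂ (proj₂ (x-kunz i))))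
      a-min = proj₂ (proj₂ (proj₂ (proj₂ (x-kunz i))))
      coord-a : M ℚ.* coord m x (suc r) ℚ.+ ℚof (suc r) ≡ ℚof a
      coord-a = begin
        M ℚ.* coord m x (suc r) ℚ.+ ℚof (suc r)         ≡⟨ cong (λ c → M ℚ.* c ℚ.+ ℚof (suc r)) (coord-suc r r<m-1) ⟩
        M ℚ.* x i ℚ.+ ℚof (suc r)                       ≡⟨ cong (λ t → M ℚ.* x i ℚ.+ ℚof (suc t)) (toℕ-fromℕ< r<m-1) ⟨
        M ℚ.* x i ℚ.+ ℚof (suc (toℕ i))                 ≡⟨ proj₁ (proj₂ (x-kunz i)) ⟩
        ℚof a                                           ∎
        where open ≡-Reasoning

  A : ℕ → ℕ
  A c = apéry (c % m)

  private
    spec : ∀ c → IsApéryAt (c % m) (A c)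
    spec c = apéry-spec (c % m) (m%n<n c m)

  A-% : ∀ r → A (r % m) ≡ A r
  A-% r = cong apéry (m%n%n≡m%n r m)

  A-≡ : ∀ r → A r % m ≡ r % m
  A-≡ r = proj₁ (spec r)

  A-0 : A 0 ≡ 0
  A-0 = cong apéry (m<n⇒m%n≡m m>0)

  S-A : ∀ r → S (A r)
  S-A r = proj₁ (proj₂ (spec r))

  A-minimal : ∀ r → m ≤ A r → ¬ S (A r ∸ m)
  A-minimal r = proj₁ (proj₂ (proj₂ (spec r)))

  Kunz-coord : ∀ r → r < m → M ℚ.* coord m x r ℚ.+ ℚof r ≡ ℚof (A r)
  Kunz-coord r r<m = trans (proj₂ (proj₂ (proj₂ (apéry-spec r r<m)))) (cong (λ t → ℚof (apéry t)) (sym (m<n⇒m%n≡m r<m)))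

  yT-A : ∀ c → yT m x c ≡ ℚof (A c)
  yT-A c with c % m | m%n<n c m
  ... | zero | _ = refl
  ... | suc r | r+1<m = proj₂ (proj₂ (proj₂ (apéry-spec (suc r) r+1<m)))

  S⇒InS : ∀ {s} → S s → A s ≤ s
  S⇒InS {s} s∈S with A s ≤? s
  ... | yes A≤s = A≤s
  ... | no A≰s with ≡-mod⇒+* m (<⇒≤ (≰⇒> A≰s)) (sym (A-≡ s))
  ...   | zero , A≡ = ⊥-elim (A≰s (≤-reflexive (trans A≡ (+-identityʳ s))))
  ...   | suc t , A≡ = ⊥-elim (A-minimal s m≤A (subst S (sym A∸m) (S-+ s∈S (S-*m t))))
    where
      A≡m+ : A s ≡ m + (s + t * m)
      A≡m+ = trans A≡ (trans (cong (s +_) (+-comm m (t * m))) (trans (sym (+-assoc s (t * m) m)) (+-comm _ m)))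
      m≤A : m ≤ A s
      m≤A = subst (m ≤_) (sym A≡m+) (m≤m+n m _)
      A∸m : A s ∸ m ≡ s + t * m
      A∸m = trans (cong (_∸ m) A≡m+) (m+n∸m≡n m _)

  A-+ : ∀ a b → A (a + b) ≤ A a + A b
  A-+ a b = subst (_≤ A a + A b) A-sum (S⇒InS (S-+ (S-A a) (S-A b)))
    where
      A-sum : A (A a + A b) ≡ A (a + b)
      A-sum = cong apéry (trans (%-distribˡ-+ (A a) (A b) m)
                (trans (cong₂ (λ u v → (u + v) % m) (A-≡ a) (A-≡ b)) (sym (%-distribˡ-+ a b m))))

  A>0 : ∀ c → c % m ≢ 0 → 0 < A c
  A>0 c c≢0 with A c | A-≡ c
  ... | zero | eq = ⊥-elim (c≢0 (trans (sym eq) (m<n⇒m%n≡m m>0)))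
  ... | suc _ | _ = s≤s z≤n

  yT≡0⇒%≡0 : ∀ c → yT m x c ≡ 0ℚ → c % m ≡ 0
  yT≡0⇒%≡0 c yT≡0 with c % m ≟ 0
  ... | yes c≡0 = c≡0
  ... | no c≢0 = ⊥-elim (<⇒≢ (A>0 c c≢0) (sym (ℚof-injective {A c} {0} (trans (sym (yT-A c)) yT≡0))))

  sum-coord : ∀ i j → i < m → j < m → M ℚ.* (coord m x i ℚ.+ coord m x j) ℚ.+ ℚof (i + j) ≡ ℚof (A i + A j)
  sum-coord i j i<m j<m = begin
    M ℚ.* (cᵢ ℚ.+ cⱼ) ℚ.+ ℚof (i + j)                 ≡⟨ cong (λ t → M ℚ.* (cᵢ ℚ.+ cⱼ) ℚ.+ t) (ℚof-+ i j) ⟩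
    M ℚ.* (cᵢ ℚ.+ cⱼ) ℚ.+ (ℚof i ℚ.+ ℚof j)           ≡⟨ solve 5 (λ M a b I J → M :* (a :+ b) :+ (I :+ J) := (M :* a :+ I) :+ (M :* b :+ J))
                                                              refl M cᵢ cⱼ (ℚof i) (ℚof j) ⟩
    (M ℚ.* cᵢ ℚ.+ ℚof i) ℚ.+ (M ℚ.* cⱼ ℚ.+ ℚof j)     ≡⟨ cong₂ ℚ._+_ (Kunz-coord i i<m) (Kunz-coord j j<m) ⟩
    ℚof (A i) ℚ.+ ℚof (A j)                          ≡⟨ ℚof-+ (A i) (A j) ⟨
    ℚof (A i + A j)                                  ∎
    where
      open ≡-Reasoning
      cᵢ = coord m x i
      cⱼ = coord m x j

  Additive : ℕ → ℕ → Set
  Additive i j = A i + A j ≡ A (i + j)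

  AdditivePair : ℕ × ℕ → Set
  AdditivePair ij = Additive (proj₁ ij) (proj₂ ij)

  Additive-sym : ∀ {i j} → Additive i j → Additive j i
  Additive-sym {i} {j} additive = trans (+-comm (A j) (A i)) (trans additive (cong A (+-comm i j)))

  Tight⇔Additive : ∀ e → (Tight m x e → AdditivePair (pairOf e)) × (AdditivePair (pairOf e) → Tight m x e)
  Tight⇔Additive (lower i j _ _ i+j<m) =
    affine-≡⇔ m _ _ (i + j) (A i + A j) (A (i + j)) (sum-coord i j i<m j<m) (Kunz-coord (i + j) i+j<m)
    where
      i<m = ≤-<-trans (m≤m+n i j) i+j<m
      j<m = ≤-<-trans (m≤n+m j i) i+j<m
  Tight⇔Additive (upper i j _ i≤j j<m m<i+j) =
    let (to , from) = affine-≡⇔ m _ _ d (A i + A j) (A d) shifted (Kunz-coord d d<m)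
    in (λ t → trans (to t) A-d) , (λ additive → from (trans additive (sym A-d)))
    where
      d = i + j ∸ m
      i+j≡m+d : i + j ≡ m + d
      i+j≡m+d = sym (m+[n∸m]≡n (<⇒≤ m<i+j))
      d<m : d < m
      d<m = +-cancelˡ-< m d m (subst (_< m + m) i+j≡m+d (+-mono-< (≤-<-trans i≤j j<m) j<m))
      A-d : A d ≡ A (i + j)
      A-d = cong apéry (m≤n⇒[n∸m]%m≡n%m (<⇒≤ m<i+j))
      shifted : M ℚ.* (coord m x i ℚ.+ coord m x j ℚ.+ 1ℚ) ℚ.+ ℚof d ≡ ℚof (A i + A j)
      shifted = begin
        M ℚ.* (cᵢ ℚ.+ cⱼ ℚ.+ 1ℚ) ℚ.+ ℚof d
          ≡⟨ solve 4 (λ M a b D → M :* (a :+ b :+ con 1ℚ) :+ D := M :* (a :+ b) :+ (M :+ D)) refl M cᵢ cⱼ (ℚof d) ⟩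
        M ℚ.* (cᵢ ℚ.+ cⱼ) ℚ.+ (M ℚ.+ ℚof d)
          ≡⟨ cong (λ t → M ℚ.* (cᵢ ℚ.+ cⱼ) ℚ.+ t) (trans (sym (ℚof-+ m d)) (cong ℚof (sym i+j≡m+d))) ⟩
        M ℚ.* (cᵢ ℚ.+ cⱼ) ℚ.+ ℚof (i + j)
          ≡⟨ sum-coord i j (≤-<-trans i≤j j<m) j<m ⟩
        ℚof (A i + A j) ∎
        where
          open ≡-Reasoning
          cᵢ = coord m x i
          cⱼ = coord m x j

-- Faces and atoms

subMod-≡0⇒≡-mod : ∀ m .{{_ : NonZero m}} a b → subMod m b a ≡ 0 → a % m ≡ b % m
subMod-≡0⇒≡-mod m a b b-a≡0 = begin
  a % m                                       ≡⟨ trans (m%n%n≡m%n (a % m) m) (m%n%n≡m%n a m) ⟨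
  (0 + a % m % m) % m                         ≡⟨ cong (λ t → (t + a % m % m) % m) b-a≡0 ⟨
  ((b + (m ∸ a % m)) % m + a % m % m) % m     ≡⟨ %-distribˡ-+ (b + (m ∸ a % m)) (a % m) m ⟨
  (b + (m ∸ a % m) + a % m) % m               ≡⟨ cong (_% m) (trans (+-assoc b _ _) (cong (b +_) (m∸n+n≡m (<⇒≤ (m%n<n a m))))) ⟩
  (b + m) % m                                 ≡⟨ [m+n]%n≡m%n b m ⟩
  b % m                                       ∎
  where open ≡-Reasoning

subMod-%ˡ : ∀ m .{{_ : NonZero m}} a b → subMod m (b % m) a ≡ subMod m b a
subMod-%ˡ m a b = begin
  (b % m + (m ∸ a % m)) % m               ≡⟨ %-distribˡ-+ (b % m) (m ∸ a % m) m ⟩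
  (b % m % m + (m ∸ a % m) % m) % m       ≡⟨ cong (λ t → (t + (m ∸ a % m) % m) % m) (m%n%n≡m%n b m) ⟩
  (b % m + (m ∸ a % m) % m) % m           ≡⟨ %-distribˡ-+ b (m ∸ a % m) m ⟨
  (b + (m ∸ a % m)) % m                   ∎
  where open ≡-Reasoning

subMod-%ʳ : ∀ m .{{_ : NonZero m}} a b → subMod m b (a % m) ≡ subMod m b a
subMod-%ʳ m a b = cong (λ t → (b + (m ∸ t)) % m) (m%n%n≡m%n a m)

module FaceTightness (m : ℕ) .{{_ : NonZero m}} where

  %≡0⇒yT≡0 : ∀ y c → c % m ≡ 0 → yT m y c ≡ 0ℚ
  %≡0⇒yT≡0 y c c≡0 with c % m | c≡0
  ... | zero | _ = refl

  -- The Kunz-poset relation r₁ ≼ r₁ + r₂ on F; a zero residue relates trivially since x₀ = 0.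
  TightOn : (Pt m → Set) → ℕ → ℕ → Set
  TightOn F r₁ r₂ = r₁ ≡ 0 ⊎ r₂ ≡ 0 ⊎
    ∃ λ e → (pairOf e ≡ (r₁ , r₂) ⊎ pairOf e ≡ (r₂ , r₁)) × (∀ y → F y → Tight m y e)

  -- The inequalities that are tight at x cut out a face G with x ∈ G ⊆ F, so G = F.
  RelInt-tight : ∀ {F x} → IsFace m F → RelInt m F x → ∀ e → Tight m x e → ∀ y → F y → Tight m y e
  RelInt-tight {F} {x} (_ , E , F⇔) (Fx , F-minimal) e tight-x y Fy = proj₂ (F-minimal G G-face G⊆F Gx y Fy) e tight-x
    where
      G : Pt m → Set
      G y = InKunz m y × (∀ e → Tight m x e → Tight m y e)
      x∈P = proj₁ (proj₁ (F⇔ x) Fx)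
      Gx : G x
      Gx = x∈P , λ _ t → t
      G-face : IsFace m G
      G-face = (x , Gx) , (λ e → Tight m x e) , λ y → (λ g → g) , (λ g → g)
      G⊆F : ∀ y → G y → F y
      G⊆F y (y∈P , tight) = proj₂ (F⇔ y) (y∈P , λ e e∈E → tight e (proj₂ (proj₁ (F⇔ x) Fx) e e∈E))

  ineq-with-pair : ∀ {r₁ r₂} → 0 < r₁ → 0 < r₂ → r₁ < m → r₂ < m → r₁ + r₂ ≢ m →
                   ∃ λ (e : Ineq m) → pairOf e ≡ (r₁ , r₂) ⊎ pairOf e ≡ (r₂ , r₁)
  ineq-with-pair {r₁} {r₂} r₁>0 r₂>0 r₁<m r₂<m r₁+r₂≢m with <-cmp (r₁ + r₂) m | r₁ ≤? r₂
  ... | tri< lt _ _ | yes r₁≤r₂ = lower r₁ r₂ r₁>0 r₁≤r₂ lt , inj₁ refl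
  ... | tri< lt _ _ | no r₁≰r₂ = lower r₂ r₁ r₂>0 (<⇒≤ (≰⇒> r₁≰r₂)) (subst (_< m) (+-comm r₁ r₂) lt) , inj₂ refl
  ... | tri≈ _ eq _ | _ = ⊥-elim (r₁+r₂≢m eq)
  ... | tri> _ _ gt | yes r₁≤r₂ = upper r₁ r₂ r₁>0 r₁≤r₂ r₂<m gt , inj₁ refl
  ... | tri> _ _ gt | no r₁≰r₂ =
    upper r₂ r₁ r₂>0 (<⇒≤ (≰⇒> r₁≰r₂)) r₁<m (subst (m <_) (+-comm r₁ r₂) gt) , inj₂ refl

open FaceTightness

kunzRho : (m : ℕ) .{{_ : NonZero m}} → (Pt m → Set) → (k : ℕ) → (Fin k → ℕ) → RhoSet m k
kunzRho m F k p (ℓ , u , w) =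
  ℓ ≡ AffineAlgebra.differenceAff m (λ i → p i % m) u w × KunzPairs.KunzPair m k (λ i → p i % m) (TightOn m F) u w

module KunzFace (m : ℕ) .{{_ : NonZero m}} (F : Pt m → Set) (F-face : IsFace m F)
  (k : ℕ) (p : Fin k → ℕ) (p-atoms : AtomEnum m F k p)
  (S : ℕ → Set) (S-numerical : IsNumSemigroup S) (S-multiplicity : HasMultiplicity m S)
  (x : Pt m) (x-kunz : IsKunzTuple m S x) (x-relint : RelInt m F x)
  (n : Fin k → ℕ) (n-gen : ∀ i → IsMinGen S (n i) × n i % m ≡ p i % m) where

  open KunzTuple m S S-numerical S-multiplicity x x-kunz
  open AperyFunction m A A-% A-≡ A-0 A-+

  private
    Fx = proj₁ x-relint

  TightOn⇒Additive : ∀ {r₁ r₂} → TightOn m F r₁ r₂ → Additive r₁ r₂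
  TightOn⇒Additive {r₂ = r₂} (inj₁ refl) = cong (_+ A r₂) A-0
  TightOn⇒Additive {r₁} (inj₂ (inj₁ refl)) =
    trans (cong (A r₁ +_) A-0) (trans (+-identityʳ _) (cong A (sym (+-identityʳ r₁))))
  TightOn⇒Additive (inj₂ (inj₂ (e , inj₁ eq , tight))) =
    subst AdditivePair eq (proj₁ (Tight⇔Additive e) (tight x Fx))
  TightOn⇒Additive (inj₂ (inj₂ (e , inj₂ eq , tight))) =
    Additive-sym (subst AdditivePair eq (proj₁ (Tight⇔Additive e) (tight x Fx)))

  Additive⇒TightOn : ∀ {r₁ r₂} → r₁ < m → r₂ < m → Additive r₁ r₂ → TightOn m F r₁ r₂
  Additive⇒TightOn {r₁} {r₂} r₁<m r₂<m additive with r₁ ≟ 0 | r₂ ≟ 0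
  ... | yes r₁≡0 | _ = inj₁ r₁≡0
  ... | no _ | yes r₂≡0 = inj₂ (inj₁ r₂≡0)
  ... | no r₁≢0 | no r₂≢0 with r₁ + r₂ ≟ m
  ...   | yes r₁+r₂≡m = ⊥-elim (<⇒≢ (≤-trans (A>0 r₁ r₁%m≢0) (m≤m+n _ _)) (sym (trans additive A-m)))
    where
      r₁%m≢0 : r₁ % m ≢ 0
      r₁%m≢0 eq = r₁≢0 (trans (sym (m<n⇒m%n≡m r₁<m)) eq)
      A-m : A (r₁ + r₂) ≡ 0
      A-m = trans (cong A r₁+r₂≡m) (trans (sym (A-% m)) (trans (cong A (n%n≡0 m)) A-0))
  ...   | no r₁+r₂≢m with ineq-with-pair m (n≢0⇒n>0 r₁≢0) (n≢0⇒n>0 r₂≢0) r₁<m r₂<m r₁+r₂≢m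
  ...     | e , pair≡ = inj₂ (inj₂ (e , pair≡ , RelInt-tight m F-face x-relint e (tight-at-x pair≡)))
    where
      tight-at-x : pairOf e ≡ (r₁ , r₂) ⊎ pairOf e ≡ (r₂ , r₁) → Tight m x e
      tight-at-x (inj₁ eq) = proj₂ (Tight⇔Additive e) (subst AdditivePair (sym eq) additive)
      tight-at-x (inj₂ eq) = proj₂ (Tight⇔Additive e) (subst AdditivePair (sym eq) (Additive-sym additive))

  p%m≢0 : ∀ i → p i % m ≢ 0
  p%m≢0 i p≡0 = proj₁ (proj₁ p-atoms i) (λ y _ → %≡0⇒yT≡0 m y (p i) p≡0)

  n%m≢0 : ∀ i → n i % m ≢ 0
  n%m≢0 i n≡0 = p%m≢0 i (trans (sym (proj₂ (n-gen i))) n≡0)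

  n>0 : ∀ i → 0 < n i
  n>0 i = proj₁ (proj₂ (proj₁ (n-gen i)))

  -- A minimal generator is not m plus an element of S.
  n∈Ap : ∀ i → A (n i) ≡ n i
  n∈Ap i with InS⇒+*m (S⇒InS (proj₁ (proj₁ (n-gen i))))
  ... | zero , eq = sym (trans eq (+-identityʳ _))
  ... | suc t , eq = ⊥-elim (proj₂ (proj₂ (proj₁ (n-gen i))) (A (n i)) (suc t * m) (S-A (n i)) (S-*m (suc t))
                       (A>0 (n i) (n%m≢0 i)) (≤-trans m>0 (m≤m+n m (t * m))) (sym eq))

  Decomposes : ℕ → ℕ → Set
  Decomposes s c = 0 < c × 0 < subMod m s c × A c + A (subMod m s c) ≡ A s

  Decomposes? : ∀ s c → Dec (Decomposes s c)
  Decomposes? s c = (0 <? c) ×-dec ((0 <? subMod m s c) ×-dec (A c + A (subMod m s c) ≟ A s))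

  indecomposable-atom : ∀ s → 0 < A s → ¬ (∃ λ c → c < m × Decomposes s c) → IsAtom m F (s % m)
  indecomposable-atom s A>0′ ∄c = not-in-H , not-above
    where
      not-in-H : ¬ InH m F (s % m)
      not-in-H r∈H = <⇒≢ A>0′ (sym (begin
        A s             ≡⟨ A-% s ⟨
        A (s % m)       ≡⟨ cong A (trans (sym (m%n%n≡m%n s m)) (yT≡0⇒%≡0 (s % m) (r∈H x Fx))) ⟩
        A 0             ≡⟨ A-0 ⟩
        0               ∎))
        where open ≡-Reasoning
      not-above : ∀ c → ¬ InH m F c → ¬ SameClass m F c (s % m) → ¬ KPrec m F c (s % m)
      not-above c c∉H c≁r c≺r = ∄c (c % m , m%n<n c m , c%m>0 , d>0 , sum)
        where
          d = subMod m (s % m) c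
          c%m>0 : 0 < c % m
          c%m>0 with c % m ≟ 0
          ... | yes c≡0 = ⊥-elim (c∉H λ y _ → %≡0⇒yT≡0 m y c c≡0)
          ... | no c≢0 = n≢0⇒n>0 c≢0
          d≡ : subMod m s (c % m) ≡ d
          d≡ = trans (subMod-%ʳ m c s) (sym (subMod-%ˡ m c s))
          d>0 : 0 < subMod m s (c % m)
          d>0 with d ≟ 0
          ... | yes d≡0 = ⊥-elim (c≁r λ y _ → %≡0⇒yT≡0 m y d (trans (m%n%n≡m%n _ m) d≡0))
          ... | no d≢0 = subst (0 <_) (sym d≡) (n≢0⇒n>0 d≢0)
          sum : A (c % m) + A (subMod m s (c % m)) ≡ A s
          sum = begin
            A (c % m) + A (subMod m s (c % m))  ≡⟨ cong₂ _+_ (A-% c) (cong A d≡) ⟩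
            A c + A d                           ≡⟨ ℚof-injective (trans (ℚof-+ (A c) (A d))
                                                     (trans (cong₂ ℚ._+_ (sym (yT-A c)) (sym (yT-A d))) (trans (c≺r x Fx) (yT-A (s % m))))) ⟩
            A (s % m)                           ≡⟨ A-% s ⟩
            A s                                 ∎
            where open ≡-Reasoning

  atom-generator : ∀ s → InAp s → IsAtom m F (s % m) → ∃ λ i → n i ≡ s
  atom-generator s s∈Ap atom with proj₂ (proj₂ p-atoms) (s % m) atom
  ... | i , same = i , InAp-≡-mod (n∈Ap i) s∈Ap (begin
    n i % m         ≡⟨ proj₂ (n-gen i) ⟩
    p i % m         ≡⟨ subMod-≡0⇒≡-mod m (s % m) (p i) (trans (sym (m%n%n≡m%n _ m)) (yT≡0⇒%≡0 _ (same x Fx))) ⟨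
    s % m % m       ≡⟨ m%n%n≡m%n s m ⟩
    s % m           ∎)
    where open ≡-Reasoning

  Ap-split : ∀ s → A s ≡ s → 0 < s →
    (∃ λ c → ∃ λ d → c + d ≡ s × 0 < c × 0 < d × A c ≡ c × A d ≡ d) ⊎ (∃ λ i → n i ≡ s)
  Ap-split s s∈Ap s>0 with anyUpTo? (Decomposes? s) m
  ... | yes (c , c<m , c>0 , d>0 , sum) =
    inj₁ (A c , A d , trans sum s∈Ap , A>0 c c%m≢0 , A>0 d d%m≢0 , A-idem c , A-idem d)
    where
      d = subMod m s c
      c%m≢0 : c % m ≢ 0
      c%m≢0 eq = <⇒≢ c>0 (sym (trans (sym (m<n⇒m%n≡m c<m)) eq))
      d%m≢0 : d % m ≢ 0
      d%m≢0 eq = <⇒≢ d>0 (sym (trans (sym (m%n%n≡m%n _ m)) eq))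
  ... | no ∄c = inj₂ (atom-generator s s∈Ap (indecomposable-atom s (subst (0 <_) (sym s∈Ap) s>0) ∄c))

  q : Fin k → ℕ
  q i = p i % m

  open KunzSemantics m A A-% A-≡ A-0 A-+ k n n∈Ap n>0 Ap-split q (λ i → proj₂ (n-gen i)) (λ i → m%n<n (p i) m)
    (TightOn m F) (λ _ _ r₁<m r₂<m → TightOn⇒Additive , Additive⇒TightOn r₁<m r₂<m)
  open KunzPairs m k q (TightOn m F)
  open AffineAlgebra m

  apéryAff-value : ∀ i → M ℚ.* evalAff m (apéryAff (q i)) x ≡ ℚof (n i)
  apéryAff-value i = trans (apéryAff-eval x (q i) (n≢0⇒n>0 (p%m≢0 i)) (m%n<n (p i) m))
                           (trans (Kunz-coord (q i) (m%n<n (p i) m)) (cong ℚof (A-q i)))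

  differenceAff-value : ∀ t u w →
    (evalAff m (differenceAff q u w) x ≡ ℚof t → dot n w ≡ t * m + dot n u) ×
    (dot n w ≡ t * m + dot n u → evalAff m (differenceAff q u w) x ≡ ℚof t)
  differenceAff-value t u w =
    affine-≡⇔ m _ (ℚof t) (dot n u) (dot n w) (t * m + dot n u) (differenceAff-eval x q n apéryAff-value u w)
      (sym (trans (ℚof-+ (t * m) (dot n u)) (cong (ℚ._+ ℚof (dot n u)) (trans (ℚof-* t m) (ℚ.*-comm (ℚof t) M)))))

  evalRho⇒ρ-Kunz : ∀ a b → evalRho m k (kunzRho m F k p) x a b → ρ-Kunz a b
  evalRho⇒ρ-Kunz _ _ (_ , u , w , t , (refl , pair) , value , refl , refl) =
    t , u , w , refl , refl , sym (proj₁ (differenceAff-value t u w) value) , pair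

  ρ-Kunz⇒evalRho : ∀ a b → ρ-Kunz a b → evalRho m k (kunzRho m F k p) x a b
  ρ-Kunz⇒evalRho _ _ (t , u , w , refl , refl , eq , pair) =
    differenceAff q u w , u , w , t , (refl , pair) , proj₂ (differenceAff-value t u w) (sym eq) , refl , refl

  kunzRho-integral : EvalIntegral m k (kunzRho m F k p) x
  kunzRho-integral _ u w (refl , ((u-Apéry , res-u) , _) , _)
    with ≡-mod⇒+* m (InAp-≤ (IsApéry⇒InAp u-Apéry) (dot∈S w) u≡w) u≡w
    where
      u≡w : dot n u % m ≡ dot n w % m
      u≡w = trans (sym (res≡ u)) (trans res-u (res≡ w))
  ... | t , eq = t , proj₂ (differenceAff-value t u w) (trans eq (+-comm (dot n u) (t * m)))

  kunzRho-minimalPresentation : IsMinimalPresentation (φ m n) (evalRho m k (kunzRho m F k p) x)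
  kunzRho-minimalPresentation =
    IsMinimalPresentation-resp (λ { (_ ∷ _) → refl }) ρ-Kunz⇒evalRho evalRho⇒ρ-Kunz ρ-Kunz-isMinimalPresentation

corollary5p14 :
    (m : ℕ) .{{_ : NonZero m}} → 2 ≤ m →
    (F : Pt m → Set) → IsFace m F →
    (k : ℕ) (p : Fin k → ℕ) → AtomEnum m F k p →
    Σ (RhoSet m k) λ ρF →
      ∀ (S : ℕ → Set) → IsNumSemigroup S → HasMultiplicity m S →
      ∀ (x : Pt m) → IsKunzTuple m S x → RelInt m F x →
      ∀ (n : Fin k → ℕ) → (∀ i → IsMinGen S (n i) × n i % m ≡ p i % m) →
      EvalIntegral m k ρF x × IsMinimalPresentation (φ m n) (evalRho m k ρF x)
corollary5p14 m _ F F-face k p p-atoms =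
  kunzRho m F k p , λ S S-numerical S-multiplicity x x-kunz x-relint n n-gen →
    let open KunzFace m F F-face k p p-atoms S S-numerical S-multiplicity x x-kunz x-relint n n-gen
    in kunzRho-integral , kunzRho-minimalPresentation
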